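{- Let $\tau$ be a triangular partition with diagonal $\partial=\partial_\tau$ and interior $\tau^\circ=\tau\setminus\partial$. For each cell $\gamma=(i,j)\in\partial$ define $$\alpha_\gamma=\{(x,y)\in\mathbb{N}^2 : (x,y+j+1)\in\tau\},\qquad \beta_\gamma=\{(x,y)\in\mathbb{N}^2 : (x+i+1,y)\in\tau\},$$ $$\alpha_\gamma^\partial=\{(x,y)\in\alpha_\gamma : (x,y+j+1)\in\partial\}.$$ Then $$\mathcal{A}_\tau(q)=q^{|\partial|}\,\mathcal{A}_{\tau^\circ}(q)+\sum_{\gamma\in\partial} q^{|\alpha_\gamma^\partial|}\,\mathcal{A}_{\alpha_\gamma\setminus\alpha_\gamma^\partial}(q)\,\mathcal{A}_{\beta_\gamma}(q),$$ with $\mathcal{A}_\emptyset(q)=1$. In particular, at $q=1$, $$\mathcal{A}_\tau=\mathcal{A}_{\tau^\circ}+\sum_{\gamma\in\partial}\mathcal{A}_{\alpha_\gamma\setminus\alpha_\gamma^\partial}\,\mathcal{A}_{\beta_\gamma}.$$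
   Context: Partitions are identified with their diagrams: cells $(i,j)\in\mathbb{N}^2$ ($i$ column, $j$ row, starting at $0$); the north-east corner of cell $(i,j)$ is $(i+1,j+1)$. For positive reals $r,s$, $\tau_{rs}=\{(i,j)\in\mathbb{N}^2 : \frac{i+1}{r}+\frac{j+1}{s}\le 1\}$; a partition is triangular if it equals $\tau_{rs}$ for some positive reals $r,s$. A cell of a triangular partition $\tau$ is removable if removing it yields a triangular partition (a nonempty triangular partition has one or two removable cells). The diagonal $\partial_\tau$ of $\tau$ is the set of cells of $\tau$ whose north-east corners lie on the closed segment joining the north-east corners of its removable cells (if there is a single removable cell, $\partial_\tau$ consists of that cell; $\partial_\emptyset=\emptyset$). For a finite set $S\subseteq\mathbb{N}^2$, $\mathcal{A}_S(q)=\sum_{\lambda} q^{|S|-|\lambda|}$, the sum over all partitions $\lambda$ whose diagram is contained in $S$ (the $q$-area enumerator of $S$-Dyck paths), and $\mathcal{A}_S=\mathcal{A}_S(1)$. The pair $(\alpha_\gamma,\beta_\gamma)$ is the decomposition $\tau=\alpha_\gamma\odot\gamma\odot\beta_\gamma$ of the bounding lattice path of $\tau$ at the corner $\gamma$: $\tau$ is the union of the rectangle $[0,i]\times[0,j]$, the shape $\alpha_\gamma$ shifted up by $j+1$, and $\beta_\gamma$ shifted right by $i+1$.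
   Formalization: The parameters r, s of triangular partitions $\tau_{rs}$, including those that remain after deleting a removable cell, are positive rationals rather than positive reals. -}

module Defs where

open import Data.Bool using (Bool; true; false; _∧_; not; if_then_else_)
open import Data.Nat as ℕ using (ℕ; zero; suc; _∸_; _≤_; _≤ᵇ_; _≡ᵇ_; _⊓_; _⊔_)
open import Data.Integer as ℤ using (ℤ; +_)
open import Data.List using (List; []; _∷_; map; concatMap; upTo; foldr)
open import Data.Nat.ListAction using (sum)
open import Data.Bool.ListAction using (and)
open import Data.Product using (Σ; _×_; _,_)
open import Relation.Binary.PropositionalEquality using (_≡_)
open import Algebra.Bundles using (CommutativeSemiring)
open import Level using (Level)

-- Cells and (decidable) sets of cells.
-- A cell is (i , j) : i = column, j = row, both starting at 0.
-- A set of cells is given by its Boolean membership function.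

CellSet : Set
CellSet = ℕ → ℕ → Bool

-- τ_{rs} with r = n/a, s = n/b (positive rationals, written over a common
-- numerator n):  (i+1)/r + (j+1)/s ≤ 1  ⟺  a(i+1) + b(j+1) ≤ n.
tri : ℕ → ℕ → ℕ → CellSet
tri a b n i j = (a ℕ.* suc i ℕ.+ b ℕ.* suc j) ≤ᵇ n

Triangular : CellSet → Set
Triangular S =
  Σ ℕ λ a → Σ ℕ λ b → Σ ℕ λ n →
    (1 ≤ a) × (1 ≤ b) × (1 ≤ n) × (∀ i j → S i j ≡ tri a b n i j)

removeCell : CellSet → ℕ → ℕ → CellSet
removeCell S ci cj i j = S i j ∧ not ((i ≡ᵇ ci) ∧ (j ≡ᵇ cj))

Removable : CellSet → ℕ → ℕ → Set
Removable S ci cj = (S ci cj ≡ true) × Triangular (removeCell S ci cj)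

OnSegment : (x₁ y₁ x₂ y₂ x y : ℕ) → Set
OnSegment x₁ y₁ x₂ y₂ x y =
  ((+ x ℤ.- + x₁) ℤ.* (+ y₂ ℤ.- + y₁) ≡ (+ y ℤ.- + y₁) ℤ.* (+ x₂ ℤ.- + x₁))
  × (x₁ ⊓ x₂ ≤ x) × (x ≤ x₁ ⊔ x₂)
  × (y₁ ⊓ y₂ ≤ y) × (y ≤ y₁ ⊔ y₂)

-- (i , j) belongs to the diagonal ∂_S: it is a cell of S whose north-east
-- corner lies on the closed segment joining the north-east corners of
-- removable cells (c₁ = c₂ allowed: this covers the one-removable-cell case
-- and, with two removable cells, the union over pairs is the full segment;
-- with no removable cell the diagonal is empty).
InDiagonal : CellSet → ℕ → ℕ → Set
InDiagonal S i j =
  (S i j ≡ true) ×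
  Σ ℕ λ a₁ → Σ ℕ λ b₁ → Σ ℕ λ a₂ → Σ ℕ λ b₂ →
    Removable S a₁ b₁ × Removable S a₂ b₂ ×
    OnSegment (suc a₁) (suc b₁) (suc a₂) (suc b₂) (suc i) (suc j)

boxCells : ℕ → List (ℕ × ℕ)
boxCells B = concatMap (λ i → map (λ j → (i , j)) (upTo B)) (upTo B)

card : ℕ → CellSet → ℕ
card B S = sum (map (λ { (i , j) → if S i j then 1 else 0 }) (boxCells B))

-- Partitions as weakly decreasing lists of row lengths λ₀ ≥ λ₁ ≥ … of
-- length k with entries ≤ m (padded with zeros): exactly the partitions
-- fitting in an m × k box, each listed once.  Cells: (i , j) with i < λ_j.
partitionsIn : ℕ → ℕ → List (List ℕ)
partitionsIn zero    m = [] ∷ []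
partitionsIn (suc k) m =
  concatMap (λ t → map (t ∷_) (partitionsIn k t)) (upTo (suc m))

size : List ℕ → ℕ
size = sum

fitsFrom : CellSet → ℕ → List ℕ → Bool
fitsFrom S j []       = true
fitsFrom S j (l ∷ ls) = and (map (λ i → S i j) (upTo l)) ∧ fitsFrom S (suc j) ls

fits : CellSet → List ℕ → Bool
fits S = fitsFrom S 0

-- Evaluation in an arbitrary commutative semiring (so identities below are
-- identities of polynomials in q).

module _ {c ℓ : Level} (R : CommutativeSemiring c ℓ) where
  open CommutativeSemiring R

  pow : Carrier → ℕ → Carrier
  pow x zero    = 1#
  pow x (suc k) = x * pow x k

  sumR : List Carrier → Carrier
  sumR = foldr _+_ 0#

  -- 𝒜_S(q) = Σ_{λ ⊆ S} q^{|S| - |λ|}, for S contained in the box B × B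
  -- (all partitions λ ⊆ S then fit in the box as well).
  𝒜 : ℕ → CellSet → Carrier → Carrier
  𝒜 B S q = sumR (map (λ λ′ → if fits S λ′ then pow q (card B S ∸ size λ′) else 0#)
                       (partitionsIn B B))

  sumOver : ℕ → CellSet → (ℕ → ℕ → Carrier) → Carrier
  sumOver B D f = sumR (map (λ { (i , j) → if D i j then f i j else 0# }) (boxCells B))

interior : CellSet → CellSet → CellSet
interior τ D i j = τ i j ∧ not (D i j)

α : CellSet → ℕ → ℕ → CellSet
α τ gi gj x y = τ x (y ℕ.+ suc gj)

β : CellSet → ℕ → ℕ → CellSet
β τ gi gj x y = τ (x ℕ.+ suc gi) y

α∂ : CellSet → CellSet → ℕ → ℕ → CellSet
α∂ τ D gi gj x y = α τ gi gj x y ∧ D x (y ℕ.+ suc gj)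

αMinusα∂ : CellSet → CellSet → ℕ → ℕ → CellSet
αMinusα∂ τ D gi gj x y = α τ gi gj x y ∧ not (α∂ τ D gi gj x y)

{-# OPTIONS --safe #-}

-- A partition λ ⊆ τ either avoids the diagonal ∂, and then λ ⊆ τ° with the |∂| diagonal
-- cells always missing, or it has a highest diagonal cell γ = (i , j). Diagonal cells are
-- outer corners of τ (no cell of τ directly east or north of them): along the segment
-- joining the removable cells c₁, c₂, the linear form cutting c₂ off from τ increases
-- towards c₂, so a cell east of a diagonal cell would lie beyond that line, as the cell east
-- of c₁ does. Hence λ contains the rectangle below and left of γ, its rows above j form a
-- partition in α_γ avoiding ∂ (so the cells of α_γ^∂ are missing), and its cells right of
-- column i form a partition in β_γ; conversely any two such partitions glue back together.

module Submission where

open import Defs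
open import Data.Bool using (Bool; true)
open import Data.Nat using (ℕ; _≤_)
open import Data.Nat.Properties using (+-*-commutativeSemiring)
open import Data.Product using (_×_)
open import Function.Bundles using (_⇔_)
open import Relation.Binary.PropositionalEquality using (_≡_; _≢_)
open import Algebra.Bundles using (CommutativeSemiring)
open import Level using (Level)

open import Data.Bool using (false; _∧_; not; if_then_else_; T)
import Data.Bool as Bool
open import Data.Bool.ListAction using (and)
open import Data.Nat.ListAction using (sum)
open import Data.Bool.Properties using (∧-zeroʳ; ∧-identityʳ; ¬-not; not-¬; ⇔→≡)
import Data.Bool.Properties as Boolₚ
open import Data.Empty using (⊥; ⊥-elim)
open import Data.List using (List; []; _∷_; map; concatMap; upTo; applyUpTo; _++_)
import Data.List.Properties as Listₚ
import Algebra.Properties.CommutativeSemigroup as CommSemigroupProperties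
open import Data.Nat as ℕ using (zero; suc; _∸_; _<_; z≤n; s≤s)
import Data.Nat.Properties as ℕₚ
open import Data.Nat.Solver using (module +-*-Solver)
import Data.Integer as Int
import Data.Integer.Properties as ℤₚ
open import Data.Integer.Solver using () renaming (module +-*-Solver to ℤSolver)
open import Data.Product using (Σ; _,_; proj₁; proj₂)
open import Data.Sum using (_⊎_; inj₁; inj₂)
open import Function using (_∘_)
open import Function.Bundles using (Equivalence; mk⇔)
import Relation.Binary.PropositionalEquality as ≡
open import Relation.Nullary using (yes; no; does)
open import Relation.Binary.Definitions using (tri<; tri≈; tri>)
open import Relation.Nullary.Decidable using (dec-true; dec-false)

module FiniteSums {c ℓ : Level} (R : CommutativeSemiring c ℓ) where
  open CommutativeSemiring R
  open import Relation.Binary.Reasoning.Setoid setoid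

  ∑< : ℕ → (ℕ → Carrier) → Carrier
  ∑< zero    f = 0#
  ∑< (suc k) f = f 0 + ∑< k (f ∘ suc)

  ∑from : ℕ → ℕ → (ℕ → Carrier) → Carrier
  ∑from j zero    g = 0#
  ∑from j (suc k) g = g j + ∑from (suc j) k g

  ∑<-cong : ∀ k {f g : ℕ → Carrier} → (∀ i → i < k → f i ≈ g i) → ∑< k f ≈ ∑< k g
  ∑<-cong zero    f≈g = refl
  ∑<-cong (suc k) f≈g = +-cong (f≈g 0 (s≤s z≤n)) (∑<-cong k (λ i i<k → f≈g (suc i) (s≤s i<k)))

  ∑<-zero : ∀ k {f : ℕ → Carrier} → (∀ i → i < k → f i ≈ 0#) → ∑< k f ≈ 0#
  ∑<-zero zero    f≈0 = refl
  ∑<-zero (suc k) f≈0 =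
    trans (+-cong (f≈0 0 (s≤s z≤n)) (∑<-zero k (λ i i<k → f≈0 (suc i) (s≤s i<k)))) (+-identityˡ 0#)

  ∑<-distrib-+ : ∀ k (f g : ℕ → Carrier) → ∑< k (λ i → f i + g i) ≈ ∑< k f + ∑< k g
  ∑<-distrib-+ zero    f g = sym (+-identityˡ 0#)
  ∑<-distrib-+ (suc k) f g =
    trans (+-congˡ (∑<-distrib-+ k (f ∘ suc) (g ∘ suc))) (+.interchange _ _ _ _)
    where module + = CommSemigroupProperties +-commutativeSemigroup

  *-distribˡ-∑< : ∀ k a (f : ℕ → Carrier) → a * ∑< k f ≈ ∑< k (λ i → a * f i)
  *-distribˡ-∑< zero    a f = zeroʳ a
  *-distribˡ-∑< (suc k) a f = trans (distribˡ a _ _) (+-congˡ (*-distribˡ-∑< k a (f ∘ suc)))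

  ∑<-split : ∀ k l (f : ℕ → Carrier) → ∑< (k ℕ.+ l) f ≈ ∑< k f + ∑< l (λ i → f (k ℕ.+ i))
  ∑<-split zero    l f = sym (+-identityˡ _)
  ∑<-split (suc k) l f = trans (+-congˡ (∑<-split k l (f ∘ suc))) (sym (+-assoc _ _ _))

  ∑<-comm : ∀ k l (f : ℕ → ℕ → Carrier) → ∑< k (λ i → ∑< l (f i)) ≈ ∑< l (λ j → ∑< k (λ i → f i j))
  ∑<-comm zero    l f = sym (∑<-zero l (λ _ _ → refl))
  ∑<-comm (suc k) l f =
    trans (+-congˡ (∑<-comm k l (f ∘ suc))) (sym (∑<-distrib-+ l (f 0) (λ j → ∑< k (λ i → f (suc i) j))))

  ∑<-single : ∀ k d (f : ℕ → Carrier) → d < k → (∀ i → i < k → i ≢ d → f i ≈ 0#) → ∑< k f ≈ f d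
  ∑<-single (suc k) zero    f _ f≈0 =
    trans (+-congˡ (∑<-zero k (λ i i<k → f≈0 (suc i) (s≤s i<k) (λ ())))) (+-identityʳ _)
  ∑<-single (suc k) (suc d) f (s≤s d<k) f≈0 =
    trans (+-cong (f≈0 0 (s≤s z≤n) (λ ()))
                  (∑<-single k d (f ∘ suc) d<k (λ i i<k i≢d → f≈0 (suc i) (s≤s i<k) (i≢d ∘ ℕₚ.suc-injective))))
          (+-identityˡ _)

  ∑from≈∑< : ∀ j k (g : ℕ → Carrier) → ∑from j k g ≈ ∑< k (λ i → g (j ℕ.+ i))
  ∑from≈∑< j zero    g = refl
  ∑from≈∑< j (suc k) g =
    +-cong (reflexive (≡.cong g (≡.sym (ℕₚ.+-identityʳ j))))
           (trans (∑from≈∑< (suc j) k g) (∑<-cong k (λ i _ → reflexive (≡.cong g (≡.sym (ℕₚ.+-suc j i))))))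

  ∑from-cong : ∀ j k {f g : ℕ → Carrier} → (∀ i → j ≤ i → f i ≈ g i) → ∑from j k f ≈ ∑from j k g
  ∑from-cong j zero    f≈g = refl
  ∑from-cong j (suc k) f≈g = +-cong (f≈g j ℕₚ.≤-refl) (∑from-cong (suc j) k (λ i j<i → f≈g i (ℕₚ.<⇒≤ j<i)))

  ∑from-zero : ∀ j k {f : ℕ → Carrier} → (∀ i → j ≤ i → f i ≈ 0#) → ∑from j k f ≈ 0#
  ∑from-zero j zero    f≈0 = refl
  ∑from-zero j (suc k) f≈0 =
    trans (+-cong (f≈0 j ℕₚ.≤-refl) (∑from-zero (suc j) k (λ i j<i → f≈0 i (ℕₚ.<⇒≤ j<i)))) (+-identityˡ 0#)

  ∑from-split : ∀ j k l (g : ℕ → Carrier) → ∑from j (k ℕ.+ l) g ≈ ∑from j k g + ∑from (j ℕ.+ k) l g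
  ∑from-split j zero    l g = trans (reflexive (≡.cong (λ i → ∑from i l g) (≡.sym (ℕₚ.+-identityʳ j)))) (sym (+-identityˡ _))
  ∑from-split j (suc k) l g =
    trans (+-congˡ (trans (∑from-split (suc j) k l g) (+-congˡ (reflexive (≡.cong (λ i → ∑from i l g) (≡.sym (ℕₚ.+-suc j k)))))))
          (sym (+-assoc _ _ _))

  ∑<-∑from-comm : ∀ k j l (f : ℕ → ℕ → Carrier) → ∑< k (λ t → ∑from j l (f t)) ≈ ∑from j l (λ y → ∑< k (λ t → f t y))
  ∑<-∑from-comm k j l f = begin
    ∑< k (λ t → ∑from j l (f t))               ≈⟨ ∑<-cong k (λ t _ → ∑from≈∑< j l (f t)) ⟩
    ∑< k (λ t → ∑< l (λ i → f t (j ℕ.+ i)))    ≈⟨ ∑<-comm k l _ ⟩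
    ∑< l (λ i → ∑< k (λ t → f t (j ℕ.+ i)))    ≈⟨ sym (∑from≈∑< j l _) ⟩
    ∑from j l (λ y → ∑< k (λ t → f t y))       ∎

  *-distribˡ-∑from : ∀ j k a (f : ℕ → Carrier) → a * ∑from j k f ≈ ∑from j k (λ i → a * f i)
  *-distribˡ-∑from j zero    a f = zeroʳ a
  *-distribˡ-∑from j (suc k) a f = trans (distribˡ a _ _) (+-congˡ (*-distribˡ-∑from (suc j) k a f))

  ∑from-shift : ∀ j k s (g : ℕ → Carrier) → ∑from j k (λ r → g (r ℕ.+ s)) ≈ ∑from (j ℕ.+ s) k g
  ∑from-shift j zero    s g = refl
  ∑from-shift j (suc k) s g = +-congˡ (∑from-shift (suc j) k s g)

  sumR-++ : ∀ xs ys → sumR R (xs ++ ys) ≈ sumR R xs + sumR R ys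
  sumR-++ []       ys = sym (+-identityˡ _)
  sumR-++ (x ∷ xs) ys = trans (+-congˡ (sumR-++ xs ys)) (sym (+-assoc _ _ _))

  sumR-map-zero : ∀ {A : Set} (xs : List A) → sumR R (map (λ _ → 0#) xs) ≈ 0#
  sumR-map-zero []       = refl
  sumR-map-zero (x ∷ xs) = trans (+-congˡ (sumR-map-zero xs)) (+-identityʳ 0#)

  sumR-map-cong : ∀ {A : Set} {f g : A → Carrier} (xs : List A) → (∀ x → f x ≈ g x) → sumR R (map f xs) ≈ sumR R (map g xs)
  sumR-map-cong []       f≈g = refl
  sumR-map-cong (x ∷ xs) f≈g = +-cong (f≈g x) (sumR-map-cong xs f≈g)

  sumOver-cong : ∀ B D {f g : ℕ → ℕ → Carrier} → (∀ i j → f i j ≈ g i j) → sumOver R B D f ≈ sumOver R B D g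
  sumOver-cong B D f≈g = sumR-map-cong (boxCells B) (λ { (i , j) → guarded (D i j) (f≈g i j) })
    where
    guarded : ∀ b {x y} → x ≈ y → (if b then x else 0#) ≈ (if b then y else 0#)
    guarded true  x≈y = x≈y
    guarded false _   = refl

  pow-1# : ∀ k → pow R 1# k ≈ 1#
  pow-1# zero    = refl
  pow-1# (suc k) = trans (*-identityˡ _) (pow-1# k)

  sumR-map-concatMap : ∀ {A B : Set} (f : B → Carrier) (g : A → List B) (xs : List A) →
    sumR R (map f (concatMap g xs)) ≈ sumR R (map (λ x → sumR R (map f (g x))) xs)
  sumR-map-concatMap f g []       = refl
  sumR-map-concatMap f g (x ∷ xs) = begin
    sumR R (map f (g x ++ concatMap g xs))                   ≡⟨ ≡.cong (sumR R) (Listₚ.map-++ f (g x) (concatMap g xs)) ⟩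
    sumR R (map f (g x) ++ map f (concatMap g xs))           ≈⟨ sumR-++ (map f (g x)) _ ⟩
    sumR R (map f (g x)) + sumR R (map f (concatMap g xs))   ≈⟨ +-congˡ (sumR-map-concatMap f g xs) ⟩
    _                                                        ∎

  sumR-map-upTo : ∀ k (f : ℕ → Carrier) → sumR R (map f (upTo k)) ≡ ∑< k f
  sumR-map-upTo k f = ≡.trans (≡.cong (sumR R) (Listₚ.map-upTo f k)) (sumR-applyUpTo k f)
    where
    sumR-applyUpTo : ∀ k (f : ℕ → Carrier) → sumR R (applyUpTo f k) ≡ ∑< k f
    sumR-applyUpTo zero    f = ≡.refl
    sumR-applyUpTo (suc k) f = ≡.cong (f 0 +_) (sumR-applyUpTo k (f ∘ suc))

  sumR-map-boxCells : ∀ B (g : ℕ × ℕ → Carrier) → sumR R (map g (boxCells B)) ≈ ∑< B (λ i → ∑< B (λ j → g (i , j)))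
  sumR-map-boxCells B g = begin
    sumR R (map g (concatMap (λ i → map (i ,_) (upTo B)) (upTo B)))
      ≈⟨ sumR-map-concatMap g (λ i → map (i ,_) (upTo B)) (upTo B) ⟩
    sumR R (map (λ i → sumR R (map g (map (i ,_) (upTo B)))) (upTo B))
      ≈⟨ sumR-map-cong (upTo B) (λ i → reflexive (≡.trans (≡.cong (sumR R) (≡.sym (Listₚ.map-∘ (upTo B))))
                                                   (sumR-map-upTo B (λ j → g (i , j))))) ⟩
    sumR R (map (λ i → ∑< B (λ j → g (i , j))) (upTo B))
      ≡⟨ sumR-map-upTo B _ ⟩
    ∑< B (λ i → ∑< B (λ j → g (i , j))) ∎

module Guards {c ℓ : Level} (R : CommutativeSemiring c ℓ) where
  open CommutativeSemiring R
  open FiniteSums R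
  private module * = CommSemigroupProperties *-commutativeSemigroup

  guard : Bool → Carrier → Carrier → Carrier
  guard b a x = if b then a * x else 0#

  𝟙 : Bool → Carrier
  𝟙 b = if b then 1# else 0#

  guard-cong : ∀ b a {x y} → x ≈ y → guard b a x ≈ guard b a y
  guard-cong true  a x≈y = *-congˡ x≈y
  guard-cong false a x≈y = refl

  guard-zero : ∀ b a → guard b a 0# ≈ 0#
  guard-zero true  a = zeroʳ a
  guard-zero false a = refl

  guard-distrib-+ : ∀ b a x y → guard b a (x + y) ≈ guard b a x + guard b a y
  guard-distrib-+ true  a x y = distribˡ a x y
  guard-distrib-+ false a x y = sym (+-identityˡ 0#)

  guard-∑< : ∀ b a k (g : ℕ → Carrier) → guard b a (∑< k g) ≈ ∑< k (λ i → guard b a (g i))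
  guard-∑< true  a k g = *-distribˡ-∑< k a g
  guard-∑< false a k g = sym (∑<-zero k (λ _ _ → refl))

  guard-∑from : ∀ b a j k (g : ℕ → Carrier) → guard b a (∑from j k g) ≈ ∑from j k (λ i → guard b a (g i))
  guard-∑from true  a j k g = *-distribˡ-∑from j k a g
  guard-∑from false a j k g = sym (∑from-zero j k (λ _ _ → refl))

  guard-comm : ∀ b a d e x → guard b a (guard d e x) ≈ guard d e (guard b a x)
  guard-comm true  a true  e x = *.x∙yz≈y∙xz a e x
  guard-comm true  a false e x = zeroʳ a
  guard-comm false a true  e x = sym (zeroʳ e)
  guard-comm false a false e x = refl

  guard-*ˡ : ∀ b a e x → guard b a (e * x) ≈ e * guard b a x
  guard-*ˡ true  a e x = *.x∙yz≈y∙xz a e x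
  guard-*ˡ false a e x = sym (zeroʳ e)

indicator : Bool → ℕ
indicator b = if b then 1 else 0

∧-not-∧ : ∀ a b → a ∧ not (a ∧ b) ≡ a ∧ not b
∧-not-∧ true  b = ≡.refl
∧-not-∧ false b = ≡.refl

∧-of-implied : ∀ d t → (d ≡ true → t ≡ true) → t ∧ d ≡ d
∧-of-implied true  t d⇒t rewrite d⇒t ≡.refl = ≡.refl
∧-of-implied false t _   = ∧-zeroʳ t

∧-elimˡ : ∀ {a b} → a ∧ b ≡ true → a ≡ true
∧-elimˡ {true} _ = ≡.refl

∧-elimʳ : ∀ {a b} → a ∧ b ≡ true → b ≡ true
∧-elimʳ {true} b≡true = b≡true

prefixIn : CellSet → ℕ → ℕ → Bool
prefixIn S j t = and (map (λ i → S i j) (upTo t))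

module _ (S : CellSet) (j : ℕ) where

  private
    prefixIn≡ : ∀ t → prefixIn S j t ≡ and (applyUpTo (λ i → S i j) t)
    prefixIn≡ t = ≡.cong and (Listₚ.map-upTo (λ i → S i j) t)

    and-applyUpTo-elim : ∀ {h} t → and (applyUpTo h t) ≡ true → ∀ x → x < t → h x ≡ true
    and-applyUpTo-elim (suc t) all-h zero    _         = ∧-elimˡ all-h
    and-applyUpTo-elim (suc t) all-h (suc x) (s≤s x<t) = and-applyUpTo-elim t (∧-elimʳ all-h) x x<t

    and-applyUpTo-intro : ∀ {h} t → (∀ x → x < t → h x ≡ true) → and (applyUpTo h t) ≡ true
    and-applyUpTo-intro zero    h-true = ≡.refl
    and-applyUpTo-intro (suc t) h-true
      rewrite h-true 0 (s≤s z≤n) = and-applyUpTo-intro t (λ x x<t → h-true (suc x) (s≤s x<t))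

  prefixIn-elim : ∀ t → prefixIn S j t ≡ true → ∀ x → x < t → S x j ≡ true
  prefixIn-elim t p = and-applyUpTo-elim t (≡.trans (≡.sym (prefixIn≡ t)) p)

  prefixIn-intro : ∀ t → (∀ x → x < t → S x j ≡ true) → prefixIn S j t ≡ true
  prefixIn-intro t S-row = ≡.trans (prefixIn≡ t) (and-applyUpTo-intro t S-row)

  prefixIn-false : ∀ t x → x < t → S x j ≡ false → prefixIn S j t ≡ false
  prefixIn-false t x x<t x∉S = ¬-not (λ p → not-¬ (prefixIn-elim t p x x<t) x∉S)

prefixIn-cong : ∀ {S S′} j t → (∀ x → x < t → S x j ≡ S′ x j) → prefixIn S j t ≡ prefixIn S′ j t
prefixIn-cong {S} {S′} j t S≡S′ = ⇔→≡ (mk⇔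
  (λ p → prefixIn-intro S′ j t (λ x x<t → ≡.trans (≡.sym (S≡S′ x x<t)) (prefixIn-elim S j t p x x<t)))
  (λ p → prefixIn-intro S j t (λ x x<t → ≡.trans (S≡S′ x x<t) (prefixIn-elim S′ j t p x x<t))))

module ℕΣ = FiniteSums +-*-commutativeSemiring

rowLen : ℕ → CellSet → ℕ → ℕ
rowLen B S j = ℕΣ.∑< B (λ x → indicator (S x j))

cellsIn : ℕ → CellSet → ℕ → ℕ → ℕ
cellsIn B S j k = ℕΣ.∑from j k (rowLen B S)

rowLen-cong : ∀ B {S S′} j → (∀ x → S x j ≡ S′ x j) → rowLen B S j ≡ rowLen B S′ j
rowLen-cong B j S≡S′ = ℕΣ.∑<-cong B (λ x _ → ≡.cong indicator (S≡S′ x))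

∑<-indicator-all : ∀ n (h : ℕ → Bool) → (∀ i → i < n → h i ≡ true) → ℕΣ.∑< n (λ i → indicator (h i)) ≡ n
∑<-indicator-all zero    h h-true = ≡.refl
∑<-indicator-all (suc n) h h-true rewrite h-true 0 (s≤s z≤n) =
  ≡.cong suc (∑<-indicator-all n (h ∘ suc) (λ i i<n → h-true (suc i) (s≤s i<n)))

prefixIn⇒≤rowLen : ∀ B S j t → t ≤ B → prefixIn S j t ≡ true → t ≤ rowLen B S j
prefixIn⇒≤rowLen B S j t t≤B p = count (λ x → S x j) t B t≤B (prefixIn-elim S j t p)
  where
  count : ∀ (h : ℕ → Bool) t k → t ≤ k → (∀ x → x < t → h x ≡ true) → t ≤ ℕΣ.∑< k (λ x → indicator (h x))
  count h zero    k       _         _      = z≤n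
  count h (suc t) (suc k) (s≤s t≤k) h-true rewrite h-true 0 (s≤s z≤n) =
    s≤s (count (h ∘ suc) t k t≤k (λ x x<t → h-true (suc x) (s≤s x<t)))

card≡cellsIn : ∀ B S → card B S ≡ cellsIn B S 0 B
card≡cellsIn B S = ≡.trans (ℕΣ.sumR-map-boxCells B _)
                  (≡.trans (ℕΣ.∑<-comm B B _) (≡.sym (ℕΣ.∑from≈∑< 0 B (rowLen B S))))

+-∸-regroup : ∀ e r r′ t s → t ≤ r → (e ℕ.+ (r ℕ.+ r′)) ∸ (t ℕ.+ s) ≡ ((e ℕ.+ (r ∸ t)) ℕ.+ r′) ∸ s
+-∸-regroup e r r′ t s t≤r = begin
  (e ℕ.+ (r ℕ.+ r′)) ∸ (t ℕ.+ s)   ≡⟨ ≡.sym (ℕₚ.∸-+-assoc (e ℕ.+ (r ℕ.+ r′)) t s) ⟩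
  (e ℕ.+ (r ℕ.+ r′)) ∸ t ∸ s       ≡⟨ ≡.cong (_∸ s) (ℕₚ.+-∸-assoc e (ℕₚ.≤-trans t≤r (ℕₚ.m≤m+n r r′))) ⟩
  (e ℕ.+ ((r ℕ.+ r′) ∸ t)) ∸ s     ≡⟨ ≡.cong (λ z → (e ℕ.+ z) ∸ s) (ℕₚ.+-∸-comm r′ t≤r) ⟩
  (e ℕ.+ ((r ∸ t) ℕ.+ r′)) ∸ s     ≡⟨ ≡.cong (_∸ s) (≡.sym (ℕₚ.+-assoc e (r ∸ t) r′)) ⟩
  ((e ℕ.+ (r ∸ t)) ℕ.+ r′) ∸ s     ∎
  where open ≡.≡-Reasoning

card-cong : ∀ B {S S′} → (∀ i j → S i j ≡ S′ i j) → card B S ≡ card B S′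
card-cong B S≡S′ = ≡.cong sum (Listₚ.map-cong (λ { (i , j) → ≡.cong indicator (S≡S′ i j) }) (boxCells B))

card-rowsFrom : ∀ B S s → (∀ {x r} → S x r ≡ true → r < B) → s ≤ B →
  card B (λ x r → S x (r ℕ.+ s)) ≡ cellsIn B S s (B ∸ s)
card-rowsFrom B S s rows<B s≤B = begin
  card B (λ x r → S x (r ℕ.+ s))                ≡⟨ card≡cellsIn B _ ⟩
  ℕΣ.∑from 0 B (λ r → rowLen B S (r ℕ.+ s))     ≡⟨ ℕΣ.∑from-shift 0 B s (rowLen B S) ⟩
  ℕΣ.∑from s B (rowLen B S)                     ≡⟨ ≡.cong (λ k → ℕΣ.∑from s k (rowLen B S)) (≡.sym (ℕₚ.m∸n+n≡m s≤B)) ⟩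
  ℕΣ.∑from s (B ∸ s ℕ.+ s) (rowLen B S)         ≡⟨ ℕΣ.∑from-split s (B ∸ s) s (rowLen B S) ⟩
  cellsIn B S s (B ∸ s) ℕ.+ ℕΣ.∑from (s ℕ.+ (B ∸ s)) s (rowLen B S)
                                                ≡⟨ ≡.cong (cellsIn B S s (B ∸ s) ℕ.+_) (ℕΣ.∑from-zero _ s emptyRow) ⟩
  cellsIn B S s (B ∸ s) ℕ.+ 0                   ≡⟨ ℕₚ.+-identityʳ _ ⟩
  cellsIn B S s (B ∸ s)                         ∎
  where
  open ≡.≡-Reasoning
  emptyRow : ∀ r → s ℕ.+ (B ∸ s) ≤ r → rowLen B S r ≡ 0
  emptyRow r B≤r = ℕΣ.∑<-zero B (λ x _ → ≡.cong indicator
    (¬-not (λ S∈ → ℕₚ.<⇒≱ (rows<B S∈) (≡.subst (_≤ r) (ℕₚ.m+[n∸m]≡n s≤B) B≤r))))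

module RowExpansion {c ℓ : Level} (R : CommutativeSemiring c ℓ) (q : CommutativeSemiring.Carrier R) (B : ℕ) where
  open CommutativeSemiring R
  open FiniteSums R
  open Guards R
  open import Relation.Binary.Reasoning.Setoid setoid

  q^ : ℕ → Carrier
  q^ = pow R q

  q^-+ : ∀ a b → q^ (a ℕ.+ b) ≈ q^ a * q^ b
  q^-+ zero    b = sym (*-identityˡ _)
  q^-+ (suc a) b = trans (*-congˡ (q^-+ a b)) (sym (*-assoc _ _ _))

  rowTerm : CellSet → ℕ → ℕ → Carrier → Carrier
  rowTerm S j t = guard (prefixIn S j t) (q^ (rowLen B S j ∸ t))

  rowTerm-cong : ∀ S j t {x y} → x ≈ y → rowTerm S j t x ≈ rowTerm S j t y
  rowTerm-cong S j t = guard-cong (prefixIn S j t) (q^ (rowLen B S j ∸ t))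

  rowTerm-zero : ∀ S j t → rowTerm S j t 0# ≈ 0#
  rowTerm-zero S j t = guard-zero (prefixIn S j t) (q^ (rowLen B S j ∸ t))

  rowTerm-distrib-+ : ∀ S j t x y → rowTerm S j t (x + y) ≈ rowTerm S j t x + rowTerm S j t y
  rowTerm-distrib-+ S j t = guard-distrib-+ (prefixIn S j t) (q^ (rowLen B S j ∸ t))

  rowTerm-*ˡ : ∀ S j t e x → rowTerm S j t (e * x) ≈ e * rowTerm S j t x
  rowTerm-*ˡ S j t = guard-*ˡ (prefixIn S j t) (q^ (rowLen B S j ∸ t))

  rowTerm-∑< : ∀ S j t k (g : ℕ → Carrier) → rowTerm S j t (∑< k g) ≈ ∑< k (λ i → rowTerm S j t (g i))
  rowTerm-∑< S j t = guard-∑< (prefixIn S j t) (q^ (rowLen B S j ∸ t))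

  rowTerm-∑from : ∀ S j t i k (g : ℕ → Carrier) → rowTerm S j t (∑from i k g) ≈ ∑from i k (λ y → rowTerm S j t (g y))
  rowTerm-∑from S j t = guard-∑from (prefixIn S j t) (q^ (rowLen B S j ∸ t))

  rowTerm-guard : ∀ S j t b a x → rowTerm S j t (guard b a x) ≈ guard b a (rowTerm S j t x)
  rowTerm-guard S j t = guard-comm (prefixIn S j t) (q^ (rowLen B S j ∸ t))

  rowTerm-sameRow : ∀ {S S′} j t x → (∀ i → S i j ≡ S′ i j) → rowTerm S j t x ≡ rowTerm S′ j t x
  rowTerm-sameRow {S} {S′} j t x S≡S′ =
    ≡.cong₂ (λ b n → guard b (q^ (n ∸ t)) x) (prefixIn-cong {S} {S′} j t (λ i _ → S≡S′ i)) (rowLen-cong B {S} {S′} j S≡S′)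

  -- 𝒜rows S j k m: partitions with rows j, …, j+k-1 in S and row j of length ≤ m,
  -- weighted by q to the number of cells of S missed in these rows.
  𝒜rows : CellSet → ℕ → ℕ → ℕ → Carrier
  𝒜rows S j zero    m = 1#
  𝒜rows S j (suc k) m = ∑< (suc m) (λ t → rowTerm S j t (𝒜rows S (suc j) k t))

  -- 𝒜rowsPast S x d j m: like 𝒜rows S j (suc d) m, except that the top row j + d must be
  -- longer than x and that nothing above it is counted.
  𝒜rowsPast : CellSet → ℕ → ℕ → ℕ → ℕ → Carrier
  𝒜rowsPast S x zero    j m = ∑< (suc m) (λ t → rowTerm S j t (𝟙 (does (x ℕ.<? t))))
  𝒜rowsPast S x (suc d) j m = ∑< (suc m) (λ t → rowTerm S j t (𝒜rowsPast S x d (suc j) t))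

  private
    -- e counts the cells already missed in the rows below j.
    weight : CellSet → ℕ → ℕ → ℕ → List ℕ → Carrier
    weight S j k e ls = if fitsFrom S j ls then q^ ((e ℕ.+ cellsIn B S j k) ∸ size ls) else 0#

    sum-partitionsIn : ∀ S k j m e → m ≤ B →
      sumR R (map (weight S j k e) (partitionsIn k m)) ≈ q^ e * 𝒜rows S j k m
    sum-partitionsIn S zero    j m e _   = begin
      q^ (e ℕ.+ 0) + 0#  ≈⟨ +-identityʳ _ ⟩
      q^ (e ℕ.+ 0)       ≡⟨ ≡.cong q^ (ℕₚ.+-identityʳ e) ⟩
      q^ e               ≈⟨ sym (*-identityʳ _) ⟩
      q^ e * 1#          ∎
    sum-partitionsIn S (suc k) j m e m≤B = begin
      sumR R (map W (concatMap (λ t → map (t ∷_) (partitionsIn k t)) (upTo (suc m))))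
        ≈⟨ sumR-map-concatMap W (λ t → map (t ∷_) (partitionsIn k t)) (upTo (suc m)) ⟩
      sumR R (map (λ t → sumR R (map W (map (t ∷_) (partitionsIn k t)))) (upTo (suc m)))
        ≡⟨ sumR-map-upTo (suc m) _ ⟩
      ∑< (suc m) (λ t → sumR R (map W (map (t ∷_) (partitionsIn k t))))
        ≈⟨ ∑<-cong (suc m) (λ t t≤m → firstRow t (ℕₚ.≤-trans (ℕₚ.≤-pred t≤m) m≤B)) ⟩
      ∑< (suc m) (λ t → q^ e * rowTerm S j t (𝒜rows S (suc j) k t))
        ≈⟨ sym (*-distribˡ-∑< (suc m) (q^ e) (λ t → rowTerm S j t (𝒜rows S (suc j) k t))) ⟩
      q^ e * 𝒜rows S j (suc k) m ∎
      where
      W : List ℕ → Carrier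
      W = weight S j (suc k) e
      firstRow : ∀ t → t ≤ B → sumR R (map W (map (t ∷_) (partitionsIn k t))) ≈ q^ e * rowTerm S j t (𝒜rows S (suc j) k t)
      firstRow t t≤B with prefixIn S j t in p
      ... | false = begin
        sumR R (map W (map (t ∷_) (partitionsIn k t)))     ≡⟨ ≡.cong (sumR R) (≡.sym (Listₚ.map-∘ (partitionsIn k t))) ⟩
        sumR R (map (W ∘ (t ∷_)) (partitionsIn k t))       ≡⟨ ≡.cong (sumR R) (Listₚ.map-cong vanish (partitionsIn k t)) ⟩
        sumR R (map (λ _ → 0#) (partitionsIn k t))         ≈⟨ sumR-map-zero (partitionsIn k t) ⟩
        0#                                                 ≈⟨ sym (zeroʳ _) ⟩
        q^ e * 0#                                          ∎
        where
        vanish : ∀ ls → W (t ∷ ls) ≡ 0#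
        vanish ls rewrite p = ≡.refl
      ... | true = begin
        sumR R (map W (map (t ∷_) (partitionsIn k t)))     ≡⟨ ≡.cong (sumR R) (≡.sym (Listₚ.map-∘ (partitionsIn k t))) ⟩
        sumR R (map (W ∘ (t ∷_)) (partitionsIn k t))       ≡⟨ ≡.cong (sumR R) (Listₚ.map-cong dropFirstRow (partitionsIn k t)) ⟩
        sumR R (map (weight S (suc j) k e′) (partitionsIn k t))
                                                           ≈⟨ sum-partitionsIn S k (suc j) t e′ t≤B ⟩
        q^ e′ * 𝒜rows S (suc j) k t                        ≈⟨ *-congʳ (q^-+ e _) ⟩
        (q^ e * q^ (rowLen B S j ∸ t)) * 𝒜rows S (suc j) k t
                                                           ≈⟨ *-assoc _ _ _ ⟩
        q^ e * (q^ (rowLen B S j ∸ t) * 𝒜rows S (suc j) k t) ∎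
        where
        e′ : ℕ
        e′ = e ℕ.+ (rowLen B S j ∸ t)
        dropFirstRow : ∀ ls → W (t ∷ ls) ≡ weight S (suc j) k e′ ls
        dropFirstRow ls rewrite p
          | +-∸-regroup e (rowLen B S j) (cellsIn B S (suc j) k) t (size ls) (prefixIn⇒≤rowLen B S j t t≤B p) = ≡.refl

  𝒜≈𝒜rows : ∀ S → 𝒜 R B S q ≈ 𝒜rows S 0 B B
  𝒜≈𝒜rows S = begin
    𝒜 R B S q                                  ≡⟨ ≡.cong (λ n → sumR R (map (λ ls → if fits S ls then q^ (n ∸ size ls) else 0#) (partitionsIn B B))) (card≡cellsIn B S) ⟩
    sumR R (map (weight S 0 B 0) (partitionsIn B B))  ≈⟨ sum-partitionsIn S B 0 B 0 ℕₚ.≤-refl ⟩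
    1# * 𝒜rows S 0 B B                         ≈⟨ *-identityˡ _ ⟩
    𝒜rows S 0 B B                              ∎

  𝒜rowsPast-short : ∀ S x d j t → t ≤ x → 𝒜rowsPast S x d j t ≈ 0#
  𝒜rowsPast-short S x zero    j t t≤x = ∑<-zero (suc t) (λ t′ t′≤t →
    trans (rowTerm-cong S j t′ (reflexive (≡.cong 𝟙 (dec-false (x ℕ.<? t′) (ℕₚ.≤⇒≯ (ℕₚ.≤-trans (ℕₚ.≤-pred t′≤t) t≤x))))))
          (rowTerm-zero S j t′))
  𝒜rowsPast-short S x (suc d) j t t≤x = ∑<-zero (suc t) (λ t′ t′≤t →
    trans (rowTerm-cong S j t′ (𝒜rowsPast-short S x d (suc j) t′ (ℕₚ.≤-trans (ℕₚ.≤-pred t′≤t) t≤x)))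
          (rowTerm-zero S j t′))

  𝒜rows-cong : ∀ {S S′} → (∀ x y → S x y ≡ S′ x y) → ∀ j k m → 𝒜rows S j k m ≈ 𝒜rows S′ j k m
  𝒜rows-cong S≡S′ j zero    m = refl
  𝒜rows-cong {S} {S′} S≡S′ j (suc k) m = ∑<-cong (suc m) (λ t _ → row t)
    where
    row : ∀ t → rowTerm S j t (𝒜rows S (suc j) k t) ≈ rowTerm S′ j t (𝒜rows S′ (suc j) k t)
    row t = trans (reflexive (rowTerm-sameRow {S} {S′} j t (𝒜rows S (suc j) k t) (λ x → S≡S′ x j))) (rowTerm-cong S′ j t (𝒜rows-cong S≡S′ (suc j) k t))

  𝒜rows-shift : ∀ S s j k m → 𝒜rows (λ x y → S x (y ℕ.+ s)) j k m ≈ 𝒜rows S (j ℕ.+ s) k m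
  𝒜rows-shift S s j zero    m = refl
  𝒜rows-shift S s j (suc k) m =
    ∑<-cong (suc m) (λ t _ → rowTerm-cong S (j ℕ.+ s) t (𝒜rows-shift S s (suc j) k t))

  𝒜rows-empty : ∀ S j → (∀ x y → j ≤ y → S x y ≡ false) → ∀ k m → 𝒜rows S j k m ≈ 1#
  𝒜rows-empty S j S-empty zero    m = refl
  𝒜rows-empty S j S-empty (suc k) m = begin
    q^ (rowLen B S j ∸ 0) * 𝒜rows S (suc j) k 0 + ∑< m (λ t → rowTerm S j (suc t) (𝒜rows S (suc j) k (suc t)))
      ≈⟨ +-cong (*-cong (reflexive (≡.cong q^ emptyRow)) (𝒜rows-empty S (suc j) (λ x y j<y → S-empty x y (ℕₚ.<⇒≤ j<y)) k 0))
                (∑<-zero m (λ t _ → reflexive (≡.cong (λ b → guard b (q^ (rowLen B S j ∸ suc t)) (𝒜rows S (suc j) k (suc t))) (prefixIn-false S j (suc t) 0 (s≤s z≤n) (S-empty 0 j ℕₚ.≤-refl))))) ⟩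
    1# * 1# + 0#  ≈⟨ +-identityʳ _ ⟩
    1# * 1#       ≈⟨ *-identityˡ _ ⟩
    1#            ∎
    where
    emptyRow : rowLen B S j ≡ 0
    emptyRow = ℕΣ.∑<-zero B (λ x _ → ≡.cong indicator (S-empty x j ℕₚ.≤-refl))

  𝒜rows-truncate : ∀ S j k l → (∀ x y → j ℕ.+ k ≤ y → S x y ≡ false) → ∀ m → 𝒜rows S j (k ℕ.+ l) m ≈ 𝒜rows S j k m
  𝒜rows-truncate S j zero    l S-empty m =
    𝒜rows-empty S j (λ x y j≤y → S-empty x y (≡.subst (_≤ y) (≡.sym (ℕₚ.+-identityʳ j)) j≤y)) l m
  𝒜rows-truncate S j (suc k) l S-empty m =
    ∑<-cong (suc m) (λ t _ → rowTerm-cong S j t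
      (𝒜rows-truncate S (suc j) k l (λ x y le → S-empty x y (≡.subst (_≤ y) (≡.sym (ℕₚ.+-suc j k)) le)) t))

  𝒜rows-bound : ∀ S j M → (∀ x → S x j ≡ true → x < M) → ∀ k m → M ≤ m → 𝒜rows S j k m ≈ 𝒜rows S j k M
  𝒜rows-bound S j M S-row zero    m M≤m = refl
  𝒜rows-bound S j M S-row (suc k) m M≤m = begin
    ∑< (suc m) f                                      ≡⟨ ≡.cong (λ z → ∑< z f) (≡.sym (≡.cong suc (ℕₚ.m+[n∸m]≡n M≤m))) ⟩
    ∑< (suc M ℕ.+ (m ∸ M)) f                          ≈⟨ ∑<-split (suc M) (m ∸ M) f ⟩
    ∑< (suc M) f + ∑< (m ∸ M) (λ i → f (suc M ℕ.+ i)) ≈⟨ +-congˡ (∑<-zero (m ∸ M) (λ i _ → tooLong i)) ⟩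
    ∑< (suc M) f + 0#                                 ≈⟨ +-identityʳ _ ⟩
    ∑< (suc M) f                                      ∎
    where
    f : ℕ → Carrier
    f t = rowTerm S j t (𝒜rows S (suc j) k t)
    M∉S : S M j ≡ false
    M∉S = ¬-not (λ M∈S → ℕₚ.<-irrefl ≡.refl (S-row M M∈S))
    tooLong : ∀ i → f (suc M ℕ.+ i) ≈ 0#
    tooLong i rewrite prefixIn-false S j (suc M ℕ.+ i) M (s≤s (ℕₚ.m≤m+n M i)) M∉S = refl

DownClosed : CellSet → Set
DownClosed τ = ∀ {x y x′ y′} → τ x y ≡ true → x′ ≤ x → y′ ≤ y → τ x′ y′ ≡ true

InBox : ℕ → CellSet → Set
InBox B τ = ∀ {x y} → τ x y ≡ true → x < B × y < B

record IsCorner (τ : CellSet) (x y : ℕ) : Set where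
  field
    inside   : τ x y ≡ true
    eastOut  : τ (suc x) y ≡ false
    northOut : τ x (suc y) ≡ false

module RightOfCorner (B : ℕ) (τ : CellSet) (down : DownClosed τ) (box : InBox B τ)
  {x y : ℕ} (xy-corner : IsCorner τ x y) where
  open IsCorner xy-corner

  βs : CellSet
  βs = β τ x y

  x<B : x < B
  x<B = proj₁ (box inside)

  β-above : ∀ x′ r → y < r → βs x′ r ≡ false
  β-above x′ r y<r =
    ¬-not (λ β∈ → not-¬ (down β∈ (ℕₚ.≤-trans (ℕₚ.n≤1+n x) (ℕₚ.m≤n+m (suc x) x′)) y<r) northOut)

  prefixIn-split : ∀ j u → j ≤ y → prefixIn τ j (suc x ℕ.+ u) ≡ prefixIn βs j u
  prefixIn-split j u j≤y = ⇔→≡ (mk⇔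
    (λ p → prefixIn-intro βs j u (λ z z<u → prefixIn-elim τ j (suc x ℕ.+ u) p (z ℕ.+ suc x)
             (≡.subst (z ℕ.+ suc x <_) (ℕₚ.+-comm u (suc x)) (ℕₚ.+-monoˡ-< (suc x) z<u))))
    (λ p → prefixIn-intro τ j (suc x ℕ.+ u) (inτ p)))
    where
    inτ : prefixIn βs j u ≡ true → ∀ z → z < suc x ℕ.+ u → τ z j ≡ true
    inτ p z z<x+u with z ℕ.≤? x
    ... | yes z≤x = down inside z≤x j≤y
    ... | no  z≰x = ≡.subst (λ w → τ w j ≡ true) (ℕₚ.m∸n+n≡m x<z)
                      (prefixIn-elim βs j u p (z ∸ suc x)
                        (≡.subst (z ∸ suc x <_) (ℕₚ.m+n∸m≡n (suc x) u) (ℕₚ.∸-monoˡ-< z<x+u x<z)))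
      where
      x<z : x < z
      x<z = ℕₚ.≰⇒> z≰x

  rowLen-split : ∀ j → j ≤ y → rowLen B τ j ≡ suc x ℕ.+ rowLen B βs j
  rowLen-split j j≤y = begin
    ℕΣ.∑< B (λ i → indicator (τ i j))
      ≡⟨ ≡.cong (λ n → ℕΣ.∑< n (λ i → indicator (τ i j))) (≡.sym (ℕₚ.m+[n∸m]≡n x<B)) ⟩
    ℕΣ.∑< (suc x ℕ.+ B′) (λ i → indicator (τ i j))
      ≡⟨ ℕΣ.∑<-split (suc x) B′ (λ i → indicator (τ i j)) ⟩
    ℕΣ.∑< (suc x) (λ i → indicator (τ i j)) ℕ.+ ℕΣ.∑< B′ (λ i → indicator (τ (suc x ℕ.+ i) j))
      ≡⟨ ≡.cong₂ ℕ._+_ (∑<-indicator-all (suc x) (λ i → τ i j) (λ i i≤x → down inside (ℕₚ.≤-pred i≤x) j≤y))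
                       (ℕΣ.∑<-cong B′ (λ i _ → ≡.cong (λ z → indicator (τ z j)) (ℕₚ.+-comm (suc x) i))) ⟩
    suc x ℕ.+ ℕΣ.∑< B′ (λ i → indicator (βs i j))
      ≡⟨ ≡.cong (suc x ℕ.+_) (≡.sym (ℕₚ.+-identityʳ _)) ⟩
    suc x ℕ.+ (ℕΣ.∑< B′ (λ i → indicator (βs i j)) ℕ.+ 0)
      ≡⟨ ≡.cong (λ n → suc x ℕ.+ (ℕΣ.∑< B′ (λ i → indicator (βs i j)) ℕ.+ n)) (≡.sym (ℕΣ.∑<-zero (suc x) (λ i _ → beyondBox i))) ⟩
    suc x ℕ.+ (ℕΣ.∑< B′ (λ i → indicator (βs i j)) ℕ.+ ℕΣ.∑< (suc x) (λ i → indicator (βs (B′ ℕ.+ i) j)))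
      ≡⟨ ≡.cong (suc x ℕ.+_) (≡.sym (ℕΣ.∑<-split B′ (suc x) (λ i → indicator (βs i j)))) ⟩
    suc x ℕ.+ ℕΣ.∑< (B′ ℕ.+ suc x) (λ i → indicator (βs i j))
      ≡⟨ ≡.cong (λ n → suc x ℕ.+ ℕΣ.∑< n (λ i → indicator (βs i j))) (ℕₚ.m∸n+n≡m x<B) ⟩
    suc x ℕ.+ rowLen B βs j ∎
    where
    open ≡.≡-Reasoning
    B′ : ℕ
    B′ = B ∸ suc x
    beyondBox : ∀ i → indicator (βs (B′ ℕ.+ i) j) ≡ 0
    beyondBox i = ≡.cong indicator (¬-not (λ β∈ → ℕₚ.<⇒≱ (proj₁ (box β∈))
      (≡.subst (_≤ (B′ ℕ.+ i) ℕ.+ suc x) (ℕₚ.m∸n+n≡m x<B) (ℕₚ.+-monoˡ-≤ (suc x) (ℕₚ.m≤m+n B′ i)))))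

module CornerDecomposition {c ℓ : Level} (R : CommutativeSemiring c ℓ) (q : CommutativeSemiring.Carrier R)
  (B : ℕ) (τ D : CellSet) (down : DownClosed τ) (box : InBox B τ)
  (corner : ∀ {x y} → D x y ≡ true → IsCorner τ x y) where
  open CommutativeSemiring R
  open FiniteSums R
  open Guards R
  open RowExpansion R q B
  open IsCorner
  open import Relation.Binary.Reasoning.Setoid setoid

  τ° : CellSet
  τ° = interior τ D

  D⊆τ : ∀ {x y} → D x y ≡ true → τ x y ≡ true
  D⊆τ = inside ∘ corner

  corner-unique-in-row : ∀ {x d j} → D d j ≡ true → D x j ≡ true → x ≡ d
  corner-unique-in-row {x} {d} {j} Dd Dx with ℕₚ.<-cmp x d
  ... | tri≈ _ x≡d _ = x≡d
  ... | tri< x<d _ _ = ⊥-elim (not-¬ (down (D⊆τ Dd) x<d ℕₚ.≤-refl) (eastOut (corner Dx)))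
  ... | tri> _ _ d<x = ⊥-elim (not-¬ (down (D⊆τ Dx) d<x ℕₚ.≤-refl) (eastOut (corner Dd)))

  cornerInRow? : ∀ j → (∀ x → D x j ≡ false) ⊎ Σ ℕ (λ d → D d j ≡ true)
  cornerInRow? j with ℕₚ.anyUpTo? (λ x → D x j Bool.≟ true) B
  ... | yes (d , _ , Dd) = inj₂ (d , Dd)
  ... | no  none         = inj₁ (λ x → ¬-not (λ Dx → none (x , proj₁ (box (D⊆τ Dx)) , Dx)))

  rowLen-τ : ∀ j → rowLen B τ j ≡ rowLen B τ° j ℕ.+ rowLen B D j
  rowLen-τ j = ≡.trans (ℕΣ.∑<-cong B (λ x _ → indicator-split x)) (ℕΣ.∑<-distrib-+ B _ _)
    where
    indicator-split : ∀ x → indicator (τ x j) ≡ indicator (τ° x j) ℕ.+ indicator (D x j)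
    indicator-split x with D x j in Dx
    ... | true  rewrite D⊆τ Dx = ≡.refl
    ... | false with τ x j
    ...   | true  = ≡.refl
    ...   | false = ≡.refl

  -- For a corner γ = (x , y), αGF x y and 𝒜rowsPast τ x y 0 B are the row expansions of
  -- q ^ |α∂ γ| · 𝒜 (α γ ∖ α∂ γ) and of 𝒜 (β γ); cornerTerms j m y collects the partitions
  -- (rows from j on) whose highest corner lies in row y.
  αGF : ℕ → ℕ → Carrier
  αGF x y = q^ (cellsIn B D (suc y) (B ∸ suc y)) * 𝒜rows τ° (suc y) (B ∸ suc y) (suc x)

  cornerTerms : ℕ → ℕ → ℕ → Carrier
  cornerTerms j m y = ∑< B (λ x → guard (D x y) (αGF x y) (𝒜rowsPast τ x (y ∸ j) j m))

  left-of-corner : ∀ {x y x′} → D x y ≡ true → τ° x′ (suc y) ≡ true → x′ < x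
  left-of-corner Dxy τ°x′ = ℕₚ.≰⇒> (λ x≤x′ → not-¬ (down (∧-elimˡ τ°x′) x≤x′ ℕₚ.≤-refl) (northOut (corner Dxy)))

  rows-above-corner : ∀ {x y} → D x y ≡ true → ∀ k t → x < t → 𝒜rows τ° (suc y) k t ≈ 𝒜rows τ° (suc y) k (suc x)
  rows-above-corner {x} {y} Dxy k t x<t = trans (𝒜rows-bound τ° (suc y) x left k t (ℕₚ.<⇒≤ x<t))
                                                (sym (𝒜rows-bound τ° (suc y) x left k (suc x) (ℕₚ.n≤1+n x)))
    where
    left : ∀ x′ → τ° x′ (suc y) ≡ true → x′ < x
    left x′ = left-of-corner Dxy

  higherRows : ∀ j k m →
    ∑< (suc m) (λ t → rowTerm τ j t (∑from (suc j) k (cornerTerms (suc j) t))) ≈ ∑from (suc j) k (cornerTerms j m)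
  higherRows j k m = begin
    ∑< (suc m) (λ t → rowTerm τ j t (∑from (suc j) k (cornerTerms (suc j) t)))
      ≈⟨ ∑<-cong (suc m) (λ t _ → rowTerm-∑from τ j t (suc j) k (cornerTerms (suc j) t)) ⟩
    ∑< (suc m) (λ t → ∑from (suc j) k (λ y → rowTerm τ j t (cornerTerms (suc j) t y)))
      ≈⟨ ∑<-∑from-comm (suc m) (suc j) k (λ t y → rowTerm τ j t (cornerTerms (suc j) t y)) ⟩
    ∑from (suc j) k (λ y → ∑< (suc m) (λ t → rowTerm τ j t (cornerTerms (suc j) t y)))
      ≈⟨ ∑from-cong (suc j) k column ⟩
    ∑from (suc j) k (cornerTerms j m) ∎
    where
    column : ∀ y → suc j ≤ y → ∑< (suc m) (λ t → rowTerm τ j t (cornerTerms (suc j) t y)) ≈ cornerTerms j m y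
    column y j<y = begin
      ∑< (suc m) (λ t → rowTerm τ j t (∑< B (λ x → γ x (P x t))))
        ≈⟨ ∑<-cong (suc m) (λ t _ → rowTerm-∑< τ j t B (λ x → γ x (P x t))) ⟩
      ∑< (suc m) (λ t → ∑< B (λ x → rowTerm τ j t (γ x (P x t))))
        ≈⟨ ∑<-cong (suc m) (λ t _ → ∑<-cong B (λ x _ → rowTerm-guard τ j t (D x y) (αGF x y) (P x t))) ⟩
      ∑< (suc m) (λ t → ∑< B (λ x → γ x (rowTerm τ j t (P x t))))
        ≈⟨ ∑<-comm (suc m) B (λ t x → γ x (rowTerm τ j t (P x t))) ⟩
      ∑< B (λ x → ∑< (suc m) (λ t → γ x (rowTerm τ j t (P x t))))
        ≈⟨ ∑<-cong B (λ x _ → sym (guard-∑< (D x y) (αGF x y) (suc m) (λ t → rowTerm τ j t (P x t)))) ⟩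
      ∑< B (λ x → γ x (∑< (suc m) (λ t → rowTerm τ j t (P x t))))
        ≡⟨ ≡.cong (λ d → ∑< B (λ x → γ x (𝒜rowsPast τ x d j m))) (≡.sym (ℕₚ.+-∸-assoc 1 j<y)) ⟩
      cornerTerms j m y ∎
      where
      γ : ℕ → Carrier → Carrier
      γ x = guard (D x y) (αGF x y)
      P : ℕ → ℕ → Carrier
      P x = 𝒜rowsPast τ x (y ∸ suc j) (suc j)

  lowestRow-noCorner : ∀ j k m → (∀ x → D x j ≡ false) →
    ∑< (suc m) (λ t → rowTerm τ j t (q^ (cellsIn B D (suc j) k) * 𝒜rows τ° (suc j) k t))
      ≈ q^ (cellsIn B D j (suc k)) * 𝒜rows τ° j (suc k) m + cornerTerms j m j
  lowestRow-noCorner j k m noCorner = begin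
    ∑< (suc m) (λ t → rowTerm τ j t (Q * A t))
      ≈⟨ ∑<-cong (suc m) (λ t _ → trans (reflexive (rowTerm-sameRow {τ} {τ°} j t (Q * A t) τ≡τ°)) (rowTerm-*ˡ τ° j t Q (A t))) ⟩
    ∑< (suc m) (λ t → Q * rowTerm τ° j t (A t))
      ≈⟨ sym (*-distribˡ-∑< (suc m) Q (λ t → rowTerm τ° j t (A t))) ⟩
    Q * 𝒜rows τ° j (suc k) m
      ≡⟨ ≡.cong (λ n → q^ (n ℕ.+ cellsIn B D (suc j) k) * 𝒜rows τ° j (suc k) m) (≡.sym emptyRow) ⟩
    q^ (cellsIn B D j (suc k)) * 𝒜rows τ° j (suc k) m
      ≈⟨ sym (+-identityʳ _) ⟩
    q^ (cellsIn B D j (suc k)) * 𝒜rows τ° j (suc k) m + 0#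
      ≈⟨ +-congˡ (sym (∑<-zero B (λ x _ → reflexive (≡.cong (λ b → guard b (αGF x j) (𝒜rowsPast τ x (j ∸ j) j m)) (noCorner x))))) ⟩
    q^ (cellsIn B D j (suc k)) * 𝒜rows τ° j (suc k) m + cornerTerms j m j ∎
    where
    Q : Carrier
    Q = q^ (cellsIn B D (suc j) k)
    A : ℕ → Carrier
    A = 𝒜rows τ° (suc j) k
    τ≡τ° : ∀ x → τ x j ≡ τ° x j
    τ≡τ° x = ≡.sym (≡.trans (≡.cong (λ b → τ x j ∧ not b) (noCorner x)) (∧-identityʳ (τ x j)))
    emptyRow : rowLen B D j ≡ 0
    emptyRow = ℕΣ.∑<-zero B (λ x _ → ≡.cong indicator (noCorner x))

  module LowestRowWithCorner (j k m d : ℕ) (Dd : D d j ≡ true) (j+k≡B : j ℕ.+ suc k ≡ B) where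

    d<B : d < B
    d<B = proj₁ (box (D⊆τ Dd))

    notCorner : ∀ x → x ≢ d → D x j ≡ false
    notCorner x x≢d = ¬-not (x≢d ∘ corner-unique-in-row Dd)

    oneCell : rowLen B D j ≡ 1
    oneCell = ≡.trans (ℕΣ.∑<-single B d (λ x → indicator (D x j)) d<B (λ x _ x≢d → ≡.cong indicator (notCorner x x≢d)))
                      (≡.cong indicator Dd)

    rowLen-τ≡suc : rowLen B τ j ≡ suc (rowLen B τ° j)
    rowLen-τ≡suc = ≡.trans (rowLen-τ j) (≡.trans (≡.cong (rowLen B τ° j ℕ.+_) oneCell) (ℕₚ.+-comm _ 1))

    τ≡τ°-left : ∀ x → x < d → τ x j ≡ τ° x j
    τ≡τ°-left x x<d =
      ≡.sym (≡.trans (≡.cong (λ b → τ x j ∧ not b) (notCorner x (λ x≡d → ℕₚ.<-irrefl x≡d x<d))) (∧-identityʳ (τ x j)))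

    -- Row j of τ is row j of τ° plus the corner, which is missed by every row of length ≤ d.
    rowTerm-left : ∀ t → t ≤ d → ∀ v →
      guard (prefixIn τ j t) (q^ (rowLen B τ j ∸ t)) v ≈ q * guard (prefixIn τ° j t) (q^ (rowLen B τ° j ∸ t)) v
    rowTerm-left t t≤d v rewrite prefixIn-cong {τ} {τ°} j t (λ x x<t → τ≡τ°-left x (ℕₚ.<-≤-trans x<t t≤d)) | rowLen-τ≡suc with prefixIn τ° j t in p
    ... | true  = trans (*-congʳ (reflexive (≡.cong q^ (ℕₚ.+-∸-assoc 1 t≤len)))) (*-assoc q _ v)
      where
      t≤len : t ≤ rowLen B τ° j
      t≤len = prefixIn⇒≤rowLen B τ° j t (ℕₚ.≤-trans t≤d (ℕₚ.<⇒≤ d<B)) p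
    ... | false = sym (zeroʳ q)

    cornersAbove : ℕ
    cornersAbove = cellsIn B D (suc j) k

    A : ℕ → Carrier
    A = 𝒜rows τ° (suc j) k

    T° : ℕ → Carrier
    T° t = rowTerm τ° j t (A t)

    Tβ : ℕ → Carrier
    Tβ t = rowTerm τ j t (𝟙 (does (d ℕ.<? t)))

    B∸suc-j≡k : B ∸ suc j ≡ k
    B∸suc-j≡k = ≡.trans (≡.cong (_∸ suc j) (≡.trans (≡.sym j+k≡B) (ℕₚ.+-suc j k))) (ℕₚ.m+n∸m≡n j k)

    rowsAbove : ∀ t → d < t → q^ cornersAbove * A t ≈ q^ (cellsIn B D (suc j) (B ∸ suc j)) * 𝒜rows τ° (suc j) (B ∸ suc j) (suc d)
    rowsAbove t d<t rewrite B∸suc-j≡k = *-congˡ (rows-above-corner Dd k t d<t)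

    splitRow : ∀ t → rowTerm τ j t (q^ cornersAbove * A t) ≈ q^ (suc cornersAbove) * T° t + αGF d j * Tβ t
    splitRow t with t ℕ.≤? d
    ... | yes t≤d = begin
      rowTerm τ j t (q^ cornersAbove * A t)          ≈⟨ rowTerm-left t t≤d (q^ cornersAbove * A t) ⟩
      q * rowTerm τ° j t (q^ cornersAbove * A t)     ≈⟨ *-congˡ (rowTerm-*ˡ τ° j t (q^ cornersAbove) (A t)) ⟩
      q * (q^ cornersAbove * T° t)                   ≈⟨ sym (*-assoc q (q^ cornersAbove) (T° t)) ⟩
      q^ (suc cornersAbove) * T° t                   ≈⟨ sym (+-identityʳ _) ⟩
      q^ (suc cornersAbove) * T° t + 0#              ≈⟨ +-congˡ (sym (trans (*-congˡ Tβ≈0) (zeroʳ _))) ⟩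
      q^ (suc cornersAbove) * T° t + αGF d j * Tβ t  ∎
      where
      Tβ≈0 : guard (prefixIn τ j t) (q^ (rowLen B τ j ∸ t)) (𝟙 (does (d ℕ.<? t))) ≈ 0#
      Tβ≈0 rewrite dec-false (d ℕ.<? t) (ℕₚ.≤⇒≯ t≤d) = rowTerm-zero τ j t
    ... | no t≰d = begin
      rowTerm τ j t (q^ cornersAbove * A t)          ≈⟨ rowTerm-cong τ j t (trans (rowsAbove t d<t) (sym (*-identityʳ _))) ⟩
      rowTerm τ j t (αGF d j * 1#)         ≈⟨ rowTerm-*ˡ τ j t (αGF d j) 1# ⟩
      αGF d j * rowTerm τ j t 1#           ≡⟨ ≡.cong (λ b → αGF d j * rowTerm τ j t (𝟙 b)) (≡.sym (dec-true (d ℕ.<? t) d<t)) ⟩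
      αGF d j * Tβ t                       ≈⟨ sym (+-identityˡ _) ⟩
      0# + αGF d j * Tβ t                  ≈⟨ +-congʳ (sym (trans (*-congˡ T°≈0) (zeroʳ _))) ⟩
      q^ (suc cornersAbove) * T° t + αGF d j * Tβ t  ∎
      where
      d<t : d < t
      d<t = ℕₚ.≰⇒> t≰d
      T°≈0 : guard (prefixIn τ° j t) (q^ (rowLen B τ° j ∸ t)) (A t) ≈ 0#
      T°≈0 rewrite prefixIn-false τ° j t d d<t (≡.trans (≡.cong (λ b → τ d j ∧ not b) Dd) (∧-zeroʳ (τ d j))) = refl

    cornerTerm : cornerTerms j m j ≈ αGF d j * 𝒜rowsPast τ d 0 j m
    cornerTerm = trans
      (∑<-single B d (λ x → guard (D x j) (αGF x j) (𝒜rowsPast τ x (j ∸ j) j m)) d<B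
        (λ x _ x≢d → reflexive (≡.cong (λ b → guard b (αGF x j) (𝒜rowsPast τ x (j ∸ j) j m)) (notCorner x x≢d))))
      (reflexive (≡.cong₂ (λ b n → guard b (αGF d j) (𝒜rowsPast τ d n j m)) Dd (ℕₚ.n∸n≡0 j)))

    lowestRow : ∑< (suc m) (λ t → rowTerm τ j t (q^ cornersAbove * A t))
                  ≈ q^ (cellsIn B D j (suc k)) * 𝒜rows τ° j (suc k) m + cornerTerms j m j
    lowestRow = begin
      ∑< (suc m) (λ t → rowTerm τ j t (q^ cornersAbove * A t))
        ≈⟨ ∑<-cong (suc m) (λ t _ → splitRow t) ⟩
      ∑< (suc m) (λ t → q^ (suc cornersAbove) * T° t + αGF d j * Tβ t)
        ≈⟨ ∑<-distrib-+ (suc m) (λ t → q^ (suc cornersAbove) * T° t) (λ t → αGF d j * Tβ t) ⟩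
      ∑< (suc m) (λ t → q^ (suc cornersAbove) * T° t) + ∑< (suc m) (λ t → αGF d j * Tβ t)
        ≈⟨ +-cong (sym (*-distribˡ-∑< (suc m) (q^ (suc cornersAbove)) T°)) (sym (*-distribˡ-∑< (suc m) (αGF d j) Tβ)) ⟩
      q^ (suc cornersAbove) * 𝒜rows τ° j (suc k) m + αGF d j * ∑< (suc m) Tβ
        ≡⟨ ≡.cong (λ n → q^ (n ℕ.+ cornersAbove) * 𝒜rows τ° j (suc k) m + αGF d j * 𝒜rowsPast τ d 0 j m) (≡.sym oneCell) ⟩
      q^ (cellsIn B D j (suc k)) * 𝒜rows τ° j (suc k) m + αGF d j * 𝒜rowsPast τ d 0 j m
        ≈⟨ +-congˡ (sym cornerTerm) ⟩
      q^ (cellsIn B D j (suc k)) * 𝒜rows τ° j (suc k) m + cornerTerms j m j ∎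

  lowestRow : ∀ j k m → j ℕ.+ suc k ≡ B →
    ∑< (suc m) (λ t → rowTerm τ j t (q^ (cellsIn B D (suc j) k) * 𝒜rows τ° (suc j) k t))
      ≈ q^ (cellsIn B D j (suc k)) * 𝒜rows τ° j (suc k) m + cornerTerms j m j
  lowestRow j k m j+k≡B with cornerInRow? j
  ... | inj₁ noCorner = lowestRow-noCorner j k m noCorner
  ... | inj₂ (d , Dd) = LowestRowWithCorner.lowestRow j k m d Dd j+k≡B

  𝒜rows-decomposition : ∀ k j m → j ℕ.+ k ≡ B →
    𝒜rows τ j k m ≈ q^ (cellsIn B D j k) * 𝒜rows τ° j k m + ∑from j k (cornerTerms j m)
  𝒜rows-decomposition zero    j m _     = sym (trans (+-identityʳ _) (*-identityˡ _))
  𝒜rows-decomposition (suc k) j m j+k≡B = begin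
    ∑< (suc m) (λ t → rowTerm τ j t (𝒜rows τ (suc j) k t))
      ≈⟨ ∑<-cong (suc m) (λ t _ → rowTerm-cong τ j t (𝒜rows-decomposition k (suc j) t (≡.trans (≡.sym (ℕₚ.+-suc j k)) j+k≡B))) ⟩
    ∑< (suc m) (λ t → rowTerm τ j t (Q * A t + H t))
      ≈⟨ ∑<-cong (suc m) (λ t _ → rowTerm-distrib-+ τ j t (Q * A t) (H t)) ⟩
    ∑< (suc m) (λ t → rowTerm τ j t (Q * A t) + rowTerm τ j t (H t))
      ≈⟨ ∑<-distrib-+ (suc m) (λ t → rowTerm τ j t (Q * A t)) (λ t → rowTerm τ j t (H t)) ⟩
    ∑< (suc m) (λ t → rowTerm τ j t (Q * A t)) + ∑< (suc m) (λ t → rowTerm τ j t (H t))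
      ≈⟨ +-cong (lowestRow j k m j+k≡B) (higherRows j k m) ⟩
    (q^ (cellsIn B D j (suc k)) * 𝒜rows τ° j (suc k) m + cornerTerms j m j) + ∑from (suc j) k (cornerTerms j m)
      ≈⟨ +-assoc _ _ _ ⟩
    q^ (cellsIn B D j (suc k)) * 𝒜rows τ° j (suc k) m + ∑from j (suc k) (cornerTerms j m) ∎
    where
    Q : Carrier
    Q = q^ (cellsIn B D (suc j) k)
    A : ℕ → Carrier
    A = 𝒜rows τ° (suc j) k
    H : ℕ → Carrier
    H t = ∑from (suc j) k (cornerTerms (suc j) t)

  module CornerFactors (x y : ℕ) (Dxy : D x y ≡ true) where

    open RightOfCorner B τ down box (corner Dxy)

    y<B : y < B
    y<B = proj₂ (box (D⊆τ Dxy))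

    rowTerm-β : ∀ j u v → j ≤ y → rowTerm τ j (suc x ℕ.+ u) v ≡ rowTerm βs j u v
    rowTerm-β j u v j≤y = ≡.cong₂ (λ b n → guard b (q^ n) v) (prefixIn-split j u j≤y)
      (≡.trans (≡.cong (_∸ (suc x ℕ.+ u)) (rowLen-split j j≤y)) (ℕₚ.[m+n]∸[m+o]≡n∸o (suc x) (rowLen B βs j) u))

    dropShortRows : ∀ j m (g : ℕ → Carrier) → j ≤ y → x < m →
      ∑< (suc x) (λ t → rowTerm τ j t (g t)) ≈ 0# →
      ∑< (suc m) (λ t → rowTerm τ j t (g t)) ≈ ∑< (suc (m ∸ suc x)) (λ u → rowTerm βs j u (g (suc x ℕ.+ u)))
    dropShortRows j m g j≤y x<m short = begin
      ∑< (suc m) f                                         ≡⟨ ≡.cong (λ n → ∑< n f) (≡.sym m≡x+m′) ⟩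
      ∑< (suc x ℕ.+ suc m′) f                              ≈⟨ ∑<-split (suc x) (suc m′) f ⟩
      ∑< (suc x) f + ∑< (suc m′) (λ u → f (suc x ℕ.+ u))  ≈⟨ +-congʳ short ⟩
      0# + ∑< (suc m′) (λ u → f (suc x ℕ.+ u))            ≈⟨ +-identityˡ _ ⟩
      ∑< (suc m′) (λ u → f (suc x ℕ.+ u))                 ≈⟨ ∑<-cong (suc m′) (λ u _ → reflexive (rowTerm-β j u (g (suc x ℕ.+ u)) j≤y)) ⟩
      ∑< (suc m′) (λ u → rowTerm βs j u (g (suc x ℕ.+ u))) ∎
      where
      m′ : ℕ
      m′ = m ∸ suc x
      m≡x+m′ : suc x ℕ.+ suc m′ ≡ suc m
      m≡x+m′ = ≡.trans (ℕₚ.+-suc (suc x) m′) (≡.cong suc (ℕₚ.m+[n∸m]≡n x<m))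
      f : ℕ → Carrier
      f t = rowTerm τ j t (g t)

    𝒜rowsPast≈𝒜rows : ∀ d j m → j ℕ.+ d ≡ y → x < m → 𝒜rowsPast τ x d j m ≈ 𝒜rows βs j (suc d) (m ∸ suc x)
    𝒜rowsPast≈𝒜rows zero    j m j+0≡y x<m =
      trans (dropShortRows j m (λ t → 𝟙 (does (x ℕ.<? t))) (≡.subst (j ≤_) j+0≡y (ℕₚ.m≤m+n j 0)) x<m
                           (𝒜rowsPast-short τ x 0 j x ℕₚ.≤-refl))
            (∑<-cong (suc (m ∸ suc x)) (λ u _ → rowTerm-cong βs j u
              (reflexive (≡.cong 𝟙 (dec-true (x ℕ.<? suc x ℕ.+ u) (s≤s (ℕₚ.m≤m+n x u)))))))
    𝒜rowsPast≈𝒜rows (suc d) j m j+d≡y x<m =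
      trans (dropShortRows j m (𝒜rowsPast τ x d (suc j)) (≡.subst (j ≤_) j+d≡y (ℕₚ.m≤m+n j (suc d))) x<m
                           (𝒜rowsPast-short τ x (suc d) j x ℕₚ.≤-refl))
            (∑<-cong (suc (m ∸ suc x)) (λ u _ → rowTerm-cong βs j u
              (trans (𝒜rowsPast≈𝒜rows d (suc j) (suc x ℕ.+ u) (≡.trans (≡.sym (ℕₚ.+-suc j d)) j+d≡y) (s≤s (ℕₚ.m≤m+n x u)))
                     (reflexive (≡.cong (𝒜rows βs (suc j) (suc d)) (ℕₚ.m+n∸m≡n (suc x) u))))))

    𝒜β : 𝒜 R B βs q ≈ 𝒜rowsPast τ x y 0 B
    𝒜β = begin
      𝒜 R B βs q                               ≈⟨ 𝒜≈𝒜rows βs ⟩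
      𝒜rows βs 0 B B                           ≈⟨ 𝒜rows-bound βs 0 (B ∸ suc x) firstRow B B (ℕₚ.m∸n≤m B (suc x)) ⟩
      𝒜rows βs 0 B (B ∸ suc x)                 ≡⟨ ≡.cong (λ k → 𝒜rows βs 0 k (B ∸ suc x)) (≡.sym (ℕₚ.m+[n∸m]≡n y<B)) ⟩
      𝒜rows βs 0 (suc y ℕ.+ (B ∸ suc y)) (B ∸ suc x)
                                               ≈⟨ 𝒜rows-truncate βs 0 (suc y) (B ∸ suc y) β-above (B ∸ suc x) ⟩
      𝒜rows βs 0 (suc y) (B ∸ suc x)           ≈⟨ sym (𝒜rowsPast≈𝒜rows y 0 B ≡.refl x<B) ⟩
      𝒜rowsPast τ x y 0 B                      ∎
      where
      firstRow : ∀ x′ → βs x′ 0 ≡ true → x′ < B ∸ suc x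
      firstRow x′ β∈ = ℕₚ.m+n≤o⇒m≤o∸n (suc x′) (proj₁ (box β∈))

    𝒜α : 𝒜 R B (αMinusα∂ τ D x y) q ≈ 𝒜rows τ° (suc y) (B ∸ suc y) (suc x)
    𝒜α = begin
      𝒜 R B (αMinusα∂ τ D x y) q                       ≈⟨ 𝒜≈𝒜rows _ ⟩
      𝒜rows (αMinusα∂ τ D x y) 0 B B                   ≈⟨ 𝒜rows-cong (λ x′ r → ∧-not-∧ (τ x′ (r ℕ.+ suc y)) (D x′ (r ℕ.+ suc y))) 0 B B ⟩
      𝒜rows (λ x′ r → τ° x′ (r ℕ.+ suc y)) 0 B B       ≈⟨ 𝒜rows-shift τ° (suc y) 0 B B ⟩
      𝒜rows τ° (suc y) B B                             ≡⟨ ≡.cong (λ k → 𝒜rows τ° (suc y) k B) (≡.sym (ℕₚ.m∸n+n≡m y<B)) ⟩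
      𝒜rows τ° (suc y) (B ∸ suc y ℕ.+ suc y) B         ≈⟨ 𝒜rows-truncate τ° (suc y) (B ∸ suc y) (suc y) aboveBox B ⟩
      𝒜rows τ° (suc y) (B ∸ suc y) B                   ≈⟨ rows-above-corner Dxy (B ∸ suc y) B x<B ⟩
      𝒜rows τ° (suc y) (B ∸ suc y) (suc x)             ∎
      where
      aboveBox : ∀ x′ r → suc y ℕ.+ (B ∸ suc y) ≤ r → τ° x′ r ≡ false
      aboveBox x′ r B≤r = ¬-not (λ τ°∈ → ℕₚ.<⇒≱ (proj₂ (box (∧-elimˡ τ°∈))) (≡.subst (_≤ r) (ℕₚ.m+[n∸m]≡n y<B) B≤r))

    card-α∂ : card B (α∂ τ D x y) ≡ cellsIn B D (suc y) (B ∸ suc y)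
    card-α∂ = ≡.trans (card-cong B (λ x′ r → ∧-of-implied (D x′ (r ℕ.+ suc y)) (τ x′ (r ℕ.+ suc y)) D⊆τ))
                      (card-rowsFrom B D (suc y) (λ D∈ → proj₂ (box (D⊆τ D∈))) y<B)

    cornerTerm≈ : (q^ (card B (α∂ τ D x y)) * 𝒜 R B (αMinusα∂ τ D x y) q) * 𝒜 R B (β τ x y) q
                    ≈ αGF x y * 𝒜rowsPast τ x y 0 B
    cornerTerm≈ = *-cong (*-cong (reflexive (≡.cong q^ card-α∂)) 𝒜α) 𝒜β

  𝒜-corner-decomposition :
    𝒜 R B τ q ≈ q^ (card B D) * 𝒜 R B τ° q
                + sumOver R B D (λ x y → (q^ (card B (α∂ τ D x y)) * 𝒜 R B (αMinusα∂ τ D x y) q) * 𝒜 R B (β τ x y) q)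
  𝒜-corner-decomposition = begin
    𝒜 R B τ q                                                       ≈⟨ 𝒜≈𝒜rows τ ⟩
    𝒜rows τ 0 B B                                                   ≈⟨ 𝒜rows-decomposition B 0 B ≡.refl ⟩
    q^ (cellsIn B D 0 B) * 𝒜rows τ° 0 B B + ∑from 0 B (cornerTerms 0 B)
      ≈⟨ +-cong (*-cong (reflexive (≡.cong q^ (≡.sym (card≡cellsIn B D)))) (sym (𝒜≈𝒜rows τ°))) (sym cornerSum) ⟩
    q^ (card B D) * 𝒜 R B τ° q + sumOver R B D F                    ∎
    where
    F : ℕ → ℕ → Carrier
    F x y = (q^ (card B (α∂ τ D x y)) * 𝒜 R B (αMinusα∂ τ D x y) q) * 𝒜 R B (β τ x y) q
    term : ∀ x y → (if D x y then F x y else 0#) ≈ guard (D x y) (αGF x y) (𝒜rowsPast τ x y 0 B)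
    term x y with D x y in Dxy
    ... | true  = CornerFactors.cornerTerm≈ x y Dxy
    ... | false = refl
    cornerSum : sumOver R B D F ≈ ∑from 0 B (cornerTerms 0 B)
    cornerSum = begin
      sumOver R B D F                                        ≈⟨ sumR-map-boxCells B _ ⟩
      ∑< B (λ x → ∑< B (λ y → if D x y then F x y else 0#))  ≈⟨ ∑<-comm B B _ ⟩
      ∑< B (λ y → ∑< B (λ x → if D x y then F x y else 0#))  ≈⟨ ∑<-cong B (λ y _ → ∑<-cong B (λ x _ → term x y)) ⟩
      ∑< B (cornerTerms 0 B)                                 ≈⟨ sym (∑from≈∑< 0 B (cornerTerms 0 B)) ⟩
      ∑from 0 B (cornerTerms 0 B)                            ∎

module SegmentArithmetic where
  open Data.Nat using (_+_; _*_)
  open Int using (ℤ; +_) renaming (_+_ to _+ᶻ_; _*_ to _*ᶻ_; _-_ to _-ᶻ_)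
  open +-*-Solver using (solve; _:+_; _:*_; _:=_; con)
  open ≡ using (refl; sym; trans; cong)

  -- det (Z − P , P′ − P) = 0 for P = (p , r), P′ = (p′ , r′), Z = (X , Y), with the
  -- negative terms moved across so that it is an equation between natural numbers.
  record Collinear (p r p′ r′ X Y : ℕ) : Set where
    constructor collinear
    field
      equation : X * r′ + Y * p + r * p′ ≡ X * r + p * r′ + Y * p′

  onSegment⇒collinear : ∀ {p r p′ r′ X Y} → OnSegment p r p′ r′ X Y → Collinear p r p′ r′ X Y
  onSegment⇒collinear {p} {r} {p′} {r′} {X} {Y} (det≡0 , _) = collinear (ℤₚ.+-injective (begin
    + (X * r′ + Y * p + r * p′)                     ≡⟨ pos-poly X r′ Y p r p′ ⟩
    ⟦ + X , + r′ , + Y , + p , + r , + p′ ⟧         ≡⟨ expand (+ X) (+ Y) (+ p) (+ r) (+ p′) (+ r′) ⟩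
    ⟦ + X , + r , + p , + r′ , + Y , + p′ ⟧ +ᶻ (L -ᶻ R)
                                                    ≡⟨ cong (λ z → ⟦ + X , + r , + p , + r′ , + Y , + p′ ⟧ +ᶻ (z -ᶻ R)) det≡0 ⟩
    ⟦ + X , + r , + p , + r′ , + Y , + p′ ⟧ +ᶻ (R -ᶻ R)
                                                    ≡⟨ cong (⟦ + X , + r , + p , + r′ , + Y , + p′ ⟧ +ᶻ_) (ℤₚ.+-inverseʳ R) ⟩
    ⟦ + X , + r , + p , + r′ , + Y , + p′ ⟧ +ᶻ + 0 ≡⟨ ℤₚ.+-identityʳ _ ⟩
    ⟦ + X , + r , + p , + r′ , + Y , + p′ ⟧         ≡⟨ sym (pos-poly X r p r′ Y p′) ⟩
    + (X * r + p * r′ + Y * p′)                     ∎))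
    where
    open ≡.≡-Reasoning
    L R : ℤ
    L = (+ X -ᶻ + p) *ᶻ (+ r′ -ᶻ + r)
    R = (+ Y -ᶻ + r) *ᶻ (+ p′ -ᶻ + p)
    ⟦_,_,_,_,_,_⟧ : ℤ → ℤ → ℤ → ℤ → ℤ → ℤ → ℤ
    ⟦ a , b , c , d , e , f ⟧ = a *ᶻ b +ᶻ c *ᶻ d +ᶻ e *ᶻ f
    pos-poly : ∀ a b c d e f → + (a * b + c * d + e * f) ≡ ⟦ + a , + b , + c , + d , + e , + f ⟧
    pos-poly a b c d e f = trans (ℤₚ.pos-+ (a * b + c * d) (e * f))
      (≡.cong₂ _+ᶻ_ (trans (ℤₚ.pos-+ (a * b) (c * d)) (≡.cong₂ _+ᶻ_ (ℤₚ.pos-* a b) (ℤₚ.pos-* c d))) (ℤₚ.pos-* e f))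
    expand : ∀ X Y p r p′ r′ →
      ⟦ X , r′ , Y , p , r , p′ ⟧ ≡ ⟦ X , r , p , r′ , Y , p′ ⟧ +ᶻ ((X -ᶻ p) *ᶻ (r′ -ᶻ r) -ᶻ (Y -ᶻ r) *ᶻ (p′ -ᶻ p))
    expand = ℤSolver.solve 6 (λ X Y p r p′ r′ →
      X :*ᶻ r′ :+ᶻ Y :*ᶻ p :+ᶻ r :*ᶻ p′
        :=ᶻ (X :*ᶻ r :+ᶻ p :*ᶻ r′ :+ᶻ Y :*ᶻ p′) :+ᶻ ((X :-ᶻ p) :*ᶻ (r′ :-ᶻ r) :-ᶻ (Y :-ᶻ r) :*ᶻ (p′ :-ᶻ p))) refl
      where open ℤSolver renaming (_:+_ to _:+ᶻ_; _:*_ to _:*ᶻ_; _:-_ to _:-ᶻ_; _:=_ to _:=ᶻ_)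

  collinear-swap : ∀ {p r p′ r′ X Y} → Collinear p r p′ r′ X Y → Collinear p′ r′ p r X Y
  collinear-swap {p} {r} {p′} {r′} {X} {Y} (collinear coll) = collinear (trans
    (solve 6 (λ p r p′ r′ X Y → X :* r :+ Y :* p′ :+ r′ :* p := X :* r :+ p :* r′ :+ Y :* p′) refl p r p′ r′ X Y)
    (trans (sym coll)
    (solve 6 (λ p r p′ r′ X Y → X :* r′ :+ Y :* p :+ r :* p′ := X :* r′ :+ p′ :* r :+ Y :* p) refl p r p′ r′ X Y)))

  collinear-level : ∀ {p r X Y} → Collinear p r (suc X) Y X Y → r ≡ Y
  collinear-level {p} {r} {X} {Y} (collinear coll) = ℕₚ.+-cancelˡ-≡ (X * Y + Y * p + r * X) r Y (trans
    (solve 4 (λ p r X Y → X :* Y :+ Y :* p :+ r :* X :+ r := X :* Y :+ Y :* p :+ r :* (con 1 :+ X)) refl p r X Y)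
    (trans coll
    (solve 4 (λ p r X Y → X :* r :+ p :* Y :+ Y :* (con 1 :+ X) := X :* Y :+ Y :* p :+ r :* X :+ Y) refl p r X Y)))

  -- Along the segment from P to P′ the functional ℓ (u , v) = a u + b v is affine: with
  -- P′ = P + (1 + f , _) and Z = P + (A , _), (1 + f) (ℓ Z − ℓ P) = A (ℓ P′ − ℓ P).
  ℓ-affine : ∀ a b p r r′ f A Y → Collinear p r (suc p + f) r′ (p + A) Y →
    suc f * (a * (p + A) + b * Y) + A * (a * p + b * r) ≡ suc f * (a * p + b * r) + A * (a * (suc p + f) + b * r′)
  ℓ-affine a b p r r′ f A Y (collinear coll) = begin
    suc f * (a * (p + A) + b * Y) + A * (a * p + b * r)
      ≡⟨ solve 8 (λ a b p r f A Y r′ → (con 1 :+ f) :* (a :* (p :+ A) :+ b :* Y) :+ A :* (a :* p :+ b :* r)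
                   := a :* ((con 1 :+ f) :* p :+ (con 1 :+ f) :* A :+ A :* p) :+ b :* (A :* r :+ Y :* (con 1 :+ f))) refl a b p r f A Y r′ ⟩
    a * (suc f * p + suc f * A + A * p) + b * (A * r + Y * suc f)
      ≡⟨ cong (λ z → a * (suc f * p + suc f * A + A * p) + b * z) (sym slope) ⟩
    a * (suc f * p + suc f * A + A * p) + b * (A * r′ + r * suc f)
      ≡⟨ solve 8 (λ a b p r f A Y r′ → a :* ((con 1 :+ f) :* p :+ (con 1 :+ f) :* A :+ A :* p) :+ b :* (A :* r′ :+ r :* (con 1 :+ f))
                   := (con 1 :+ f) :* (a :* p :+ b :* r) :+ A :* (a :* (con 1 :+ p :+ f) :+ b :* r′)) refl a b p r f A Y r′ ⟩
    suc f * (a * p + b * r) + A * (a * (suc p + f) + b * r′) ∎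
    where
    open ≡.≡-Reasoning
    slope : A * r′ + r * suc f ≡ A * r + Y * suc f
    slope = ℕₚ.+-cancelˡ-≡ (p * r′ + Y * p + r * p) _ _ (trans
      (solve 6 (λ p A r′ Y r f → p :* r′ :+ Y :* p :+ r :* p :+ (A :* r′ :+ r :* (con 1 :+ f))
                  := (p :+ A) :* r′ :+ Y :* p :+ r :* (con 1 :+ p :+ f)) refl p A r′ Y r f)
      (trans coll
      (solve 6 (λ p A r′ Y r f → (p :+ A) :* r :+ p :* r′ :+ Y :* (con 1 :+ p :+ f)
                  := p :* r′ :+ Y :* p :+ r :* p :+ (A :* r :+ Y :* (con 1 :+ f))) refl p A r′ Y r f)))

  ℓ-mono-on-segment : ∀ a b {p r p′ r′ X Y} → p < p′ → p ≤ X → Collinear p r p′ r′ X Y →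
    a * p + b * r < a * p′ + b * r′ → a * p + b * r ≤ a * X + b * Y
  ℓ-mono-on-segment a b {p} {r} {p′} {r′} {X} {Y} p<p′ p≤X coll ℓP<ℓP′
    with ℕₚ.m≤n⇒∃[o]m+o≡n p<p′ | ℕₚ.m≤n⇒∃[o]m+o≡n p≤X
  ... | f , refl | A , refl = ℕₚ.≮⇒≥ (λ ℓZ<ℓP → ℕₚ.<-irrefl (ℓ-affine a b p r r′ f A Y coll)
        (ℕₚ.+-mono-<-≤ (ℕₚ.*-monoʳ-< (suc f) ℓZ<ℓP) (ℕₚ.*-monoʳ-≤ A (ℕₚ.<⇒≤ ℓP<ℓP′))))

open SegmentArithmetic

≡ᵇ-false : ∀ {m n} → m ≢ n → (m ℕ.≡ᵇ n) ≡ false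
≡ᵇ-false {m} {n} = dec-false (m ℕ.≟ n)

≡ᵇ-refl : ∀ m → (m ℕ.≡ᵇ m) ≡ true
≡ᵇ-refl m = dec-true (m ℕ.≟ m) ≡.refl

tri⇒≤ : ∀ a b n {i j} → tri a b n i j ≡ true → a ℕ.* suc i ℕ.+ b ℕ.* suc j ≤ n
tri⇒≤ a b n {i} {j} t = ℕₚ.≤ᵇ⇒≤ (a ℕ.* suc i ℕ.+ b ℕ.* suc j) n (≡.subst T (≡.sym t) _)

≤⇒tri : ∀ a b n {i j} → a ℕ.* suc i ℕ.+ b ℕ.* suc j ≤ n → tri a b n i j ≡ true
≤⇒tri a b n {i} {j} = dec-true (a ℕ.* suc i ℕ.+ b ℕ.* suc j ℕ.≤? n)

tri-downClosed : ∀ a b n → DownClosed (tri a b n)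
tri-downClosed a b n t x′≤x y′≤y =
  ≤⇒tri a b n (ℕₚ.≤-trans (ℕₚ.+-mono-≤ (ℕₚ.*-monoʳ-≤ a (s≤s x′≤x)) (ℕₚ.*-monoʳ-≤ b (s≤s y′≤y))) (tri⇒≤ a b n t))

tri-inBox : ∀ {a b} n → 1 ≤ a → 1 ≤ b → InBox n (tri a b n)
tri-inBox {suc a} {suc b} n _ _ {x} {y} t =
    ℕₚ.≤-trans (ℕₚ.≤-trans (ℕₚ.m≤n*m (suc x) (suc a)) (ℕₚ.m≤m+n _ _)) (tri⇒≤ (suc a) (suc b) n t)
  , ℕₚ.≤-trans (ℕₚ.≤-trans (ℕₚ.m≤n*m (suc y) (suc b)) (ℕₚ.m≤n+m (suc b ℕ.* suc y) (suc a ℕ.* suc x))) (tri⇒≤ (suc a) (suc b) n t)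

record Removal (τ : CellSet) (cx cy : ℕ) : Set where
  field
    inside : τ cx cy ≡ true
    a b n  : ℕ
    cut    : ∀ i j → removeCell τ cx cy i j ≡ tri a b n i j

  ℓ : ℕ → ℕ → ℕ
  ℓ u v = a ℕ.* u ℕ.+ b ℕ.* v

  ℓ-suc : ∀ u v → ℓ (suc u) v ≡ a ℕ.+ ℓ u v
  ℓ-suc u v = ≡.trans (≡.cong (ℕ._+ b ℕ.* v) (ℕₚ.*-suc a u)) (ℕₚ.+-assoc a (a ℕ.* u) (b ℕ.* v))

  kept : ∀ {i j} → τ i j ≡ true → i ≢ cx ⊎ j ≢ cy → ℓ (suc i) (suc j) ≤ n
  kept {i} {j} τij i≢cx⊎j≢cy = tri⇒≤ a b n (≡.trans (≡.sym (cut i j)) (stays i≢cx⊎j≢cy))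
    where
    stays : i ≢ cx ⊎ j ≢ cy → removeCell τ cx cy i j ≡ true
    stays (inj₁ i≢cx) rewrite τij | ≡ᵇ-false i≢cx = ≡.refl
    stays (inj₂ j≢cy) rewrite τij | ≡ᵇ-false j≢cy | ∧-zeroʳ (i ℕ.≡ᵇ cx) = ≡.refl

  private
    above : ∀ {i j} → removeCell τ cx cy i j ≡ false → n < ℓ (suc i) (suc j)
    above {i} {j} gone = ℕₚ.≰⇒> (λ ℓ≤n → not-¬ (≡.trans (cut i j) (≤⇒tri a b n ℓ≤n)) gone)

  removed : n < ℓ (suc cx) (suc cy)
  removed = above gone
    where
    gone : removeCell τ cx cy cx cy ≡ false
    gone rewrite ≡ᵇ-refl cx | ≡ᵇ-refl cy = ∧-zeroʳ (τ cx cy)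

  absent : ∀ {i j} → τ i j ≡ false → n < ℓ (suc i) (suc j)
  absent {i} {j} τij = above gone
    where
    gone : removeCell τ cx cy i j ≡ false
    gone rewrite τij = ≡.refl

  eastOut : τ (suc cx) cy ≡ false
  eastOut = ¬-not (λ τ∈ → ℕₚ.<⇒≱ removed
    (ℕₚ.≤-trans (ℕₚ.+-monoˡ-≤ (b ℕ.* suc cy) (ℕₚ.*-monoʳ-≤ a (ℕₚ.n≤1+n (suc cx)))) (kept τ∈ (inj₁ ℕₚ.1+n≢n))))

removal : ∀ {τ cx cy} → Removable τ cx cy → Removal τ cx cy
removal (inside , a , b , n , _ , _ , _ , cut) = record { inside = inside ; a = a ; b = b ; n = n ; cut = cut }

transpose : CellSet → CellSet
transpose τ i j = τ j i

transpose-downClosed : ∀ {τ} → DownClosed τ → DownClosed (transpose τ)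
transpose-downClosed down τ∈ x′≤x y′≤y = down τ∈ y′≤y x′≤x

removal-transpose : ∀ {τ cx cy} → Removal τ cx cy → Removal (transpose τ) cy cx
removal-transpose {τ} {cx} {cy} r = record
  { inside = inside
  ; a      = b
  ; b      = a
  ; n      = n
  ; cut    = λ i j → ≡.trans (≡.cong (λ z → τ j i ∧ not z) (Boolₚ.∧-comm (i ℕ.≡ᵇ cy) (j ℕ.≡ᵇ cx)))
                     (≡.trans (cut j i) (≡.cong (ℕ._≤ᵇ n) (ℕₚ.+-comm (a ℕ.* suc j) (b ℕ.* suc i))))
  }
  where open Removal r

module _ {τ : CellSet} (down : DownClosed τ) where

  eastOut-ordered : ∀ {x₁ y₁ x₂ y₂ x y} → Removal τ x₁ y₁ → Removal τ x₂ y₂ → x₁ < x₂ → x₁ ≤ x →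
    Collinear (suc x₁) (suc y₁) (suc x₂) (suc y₂) (suc x) (suc y) → τ (suc x) y ≡ false
  eastOut-ordered {x₁} {y₁} {x₂} {y₂} {x} {y} c₁ c₂ x₁<x₂ x₁≤x coll = ¬-not east∉τ
    where
    open Removal c₂
    -- ℓ increases from c₁ to c₂, so it is at least ℓ c₁ at (x , y): the cell east of (x , y)
    -- lies beyond the line of c₂ just as the cell east of c₁ does.
    beyondLine : τ (suc x) y ≡ true → suc x ≢ x₂ ⊎ y ≢ y₂ → ⊥
    beyondLine east∈τ ne = ℕₚ.<-irrefl ≡.refl (begin-strict
      n                             <⟨ absent (Removal.eastOut c₁) ⟩
      ℓ (suc (suc x₁)) (suc y₁)     ≡⟨ ℓ-suc (suc x₁) (suc y₁) ⟩
      a ℕ.+ ℓ (suc x₁) (suc y₁)     ≤⟨ ℕₚ.+-monoʳ-≤ a (ℓ-mono-on-segment a b (s≤s x₁<x₂) (s≤s x₁≤x) coll ℓc₁<ℓc₂) ⟩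
      a ℕ.+ ℓ (suc x) (suc y)       ≡⟨ ≡.sym (ℓ-suc (suc x) (suc y)) ⟩
      ℓ (suc (suc x)) (suc y)       ≤⟨ kept east∈τ ne ⟩
      n                             ∎)
      where
      open ℕₚ.≤-Reasoning
      ℓc₁<ℓc₂ : ℓ (suc x₁) (suc y₁) < ℓ (suc x₂) (suc y₂)
      ℓc₁<ℓc₂ = ℕₚ.≤-<-trans (kept (Removal.inside c₁) (inj₁ (ℕₚ.<⇒≢ x₁<x₂))) removed
    east∉τ : τ (suc x) y ≡ true → ⊥
    east∉τ east∈τ with suc x ℕ.≟ x₂ | y ℕ.≟ y₂
    ... | no  sx≢x₂ | _         = beyondLine east∈τ (inj₁ sx≢x₂)
    ... | yes _     | no  y≢y₂  = beyondLine east∈τ (inj₂ y≢y₂)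
    ... | yes ≡.refl | yes ≡.refl =
      not-¬ (down east∈τ (s≤s x₁≤x) (ℕₚ.≤-reflexive (ℕₚ.suc-injective (collinear-level coll)))) (Removal.eastOut c₁)

  diagonal-eastOut : ∀ {x y x₁ y₁ x₂ y₂} → Removal τ x₁ y₁ → Removal τ x₂ y₂ →
    OnSegment (suc x₁) (suc y₁) (suc x₂) (suc y₂) (suc x) (suc y) → τ (suc x) y ≡ false
  diagonal-eastOut {x} {y} {x₁} {y₁} {x₂} {y₂} c₁ c₂ seg@(_ , min≤x , _ , min≤y , _) with ℕₚ.<-cmp x₁ x₂
  ... | tri< x₁<x₂ _ _ =
    eastOut-ordered c₁ c₂ x₁<x₂ (ℕₚ.≤-pred (≡.subst (_≤ suc x) (ℕₚ.m≤n⇒m⊓n≡m (s≤s (ℕₚ.<⇒≤ x₁<x₂))) min≤x))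
      (onSegment⇒collinear seg)
  ... | tri> _ _ x₂<x₁ =
    eastOut-ordered c₂ c₁ x₂<x₁ (ℕₚ.≤-pred (≡.subst (_≤ suc x) (ℕₚ.m≥n⇒m⊓n≡n (s≤s (ℕₚ.<⇒≤ x₂<x₁))) min≤x))
      (collinear-swap (onSegment⇒collinear seg))
  ... | tri≈ _ ≡.refl _ = ¬-not east∉τ
    where
    x₁≤x : x₁ ≤ x
    x₁≤x = ℕₚ.≤-pred (≡.subst (_≤ suc x) (ℕₚ.⊓-idem (suc x₁)) min≤x)
    east∉τ : τ (suc x) y ≡ true → ⊥
    east∉τ east∈τ with ℕₚ.⊓-sel (suc y₁) (suc y₂)
    ... | inj₁ min≡y₁ = not-¬ (down east∈τ (s≤s x₁≤x) (ℕₚ.≤-pred (≡.subst (_≤ suc y) min≡y₁ min≤y))) (Removal.eastOut c₁)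
    ... | inj₂ min≡y₂ = not-¬ (down east∈τ (s≤s x₁≤x) (ℕₚ.≤-pred (≡.subst (_≤ suc y) min≡y₂ min≤y))) (Removal.eastOut c₂)

diagonal⇒corner : ∀ {τ x y} → DownClosed τ → InDiagonal τ x y → IsCorner τ x y
diagonal⇒corner down (inside , _ , _ , _ , _ , r₁ , r₂ , seg@(det≡0 , x-bounds₁ , x-bounds₂ , y-bounds₁ , y-bounds₂)) = record
  { inside   = inside
  ; eastOut  = diagonal-eastOut down (removal r₁) (removal r₂) seg
  ; northOut = diagonal-eastOut (transpose-downClosed down) (removal-transpose (removal r₁)) (removal-transpose (removal r₂))
                 (≡.sym det≡0 , y-bounds₁ , y-bounds₂ , x-bounds₁ , x-bounds₂)
  }

mainTheorem14 : {c ℓ : Level} →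
  (a b n : ℕ) → 1 ≤ a → 1 ≤ b → 1 ≤ n →
  (D : CellSet) → (∀ i j → (D i j ≡ true) ⇔ InDiagonal (tri a b n) i j) →
  (∀ (R : CommutativeSemiring c ℓ) (q : CommutativeSemiring.Carrier R) →
    CommutativeSemiring._≈_ R
      (𝒜 R n (tri a b n) q)
      (CommutativeSemiring._+_ R
        (CommutativeSemiring._*_ R (pow R q (card n D)) (𝒜 R n (interior (tri a b n) D) q))
        (sumOver R n D (λ gi gj →
          CommutativeSemiring._*_ R
            (CommutativeSemiring._*_ R
              (pow R q (card n (α∂ (tri a b n) D gi gj)))
              (𝒜 R n (αMinusα∂ (tri a b n) D gi gj) q))
            (𝒜 R n (β (tri a b n) gi gj) q)))))
  ×
  (𝒜 +-*-commutativeSemiring n (tri a b n) 1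
    ≡ 𝒜 +-*-commutativeSemiring n (interior (tri a b n) D) 1
      Data.Nat.+ sumOver +-*-commutativeSemiring n D (λ gi gj →
          𝒜 +-*-commutativeSemiring n (αMinusα∂ (tri a b n) D gi gj) 1
          Data.Nat.* 𝒜 +-*-commutativeSemiring n (β (tri a b n) gi gj) 1))
mainTheorem14 a b n 1≤a 1≤b _ D D⇔∂ =
    Decomposition.𝒜-corner-decomposition
  , ≡.trans (Decomposition.𝒜-corner-decomposition +-*-commutativeSemiring 1)
            (≡.cong₂ ℕ._+_ (1^-* (card n D) _)
              (ℕΣ.sumOver-cong n D (λ i j → ≡.cong (ℕ._* 𝒜 +-*-commutativeSemiring n (β (tri a b n) i j) 1)
                                                     (1^-* (card n (α∂ (tri a b n) D i j)) _))))
  where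
  corner : ∀ {x y} → D x y ≡ true → IsCorner (tri a b n) x y
  corner {x} {y} = diagonal⇒corner (tri-downClosed a b n) ∘ Equivalence.to (D⇔∂ x y)
  module Decomposition {c ℓ} (R : CommutativeSemiring c ℓ) q =
    CornerDecomposition R q n (tri a b n) D (tri-downClosed a b n) (tri-inBox n 1≤a 1≤b) corner
  1^-* : ∀ k m → pow +-*-commutativeSemiring 1 k ℕ.* m ≡ m
  1^-* k m = ≡.trans (≡.cong (ℕ._* m) (ℕΣ.pow-1# k)) (ℕₚ.*-identityˡ m)
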